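{- Let $F$ be a non-archimedean ordered field, $\mathcal{C}$ the set of all convex subgroups of $(F,+)$, and $Q=\{a+A: a\in F, A\in\mathcal{C}\}$ with operations $(a+A)+(b+B)=a+b+A+B$, $(a+A)(b+B)=ab+aB+bA+AB$, and order $\alpha\le\beta$ iff $(\forall x\in\alpha)(\exists y\in\beta)(x\le y)$. Then $(Q,+,\cdot,\le)$, with $e(a+A)=A$, $s(a+A)=-a+A$, and for $\alpha=a+A\notin\mathcal{C}$, $u(\alpha)=1+A/a$, $d(\alpha)=\frac1a+\frac{A}{a^2}$, is an ordered association.
   Context: A subset of $F$ is convex if it contains every element lying between two of its elements; sums/products of sets are elementwise, and the operations on $Q$ are independent of representatives. Write $x<y$ iff $x\le y$ and $x\ne y$. Assembly: a non-empty structure $(\mathcal{A},\ast)$ such that (1) $\ast$ is associative; (2) commutative; (3) for every $x$ there is $e$ with $x\ast e=x$ and such that $x\ast f=x$ implies $e\ast f=e$ (unique, denoted $e(x)$); (4) for every $x$ there is $s$ with $x\ast s=e(x)$ and $e(s)=e(x)$ (unique, denoted $s(x)$); (5) for all $x,y$, $e(x\ast y)=e(x)$ or $e(x\ast y)=e(y)$. Association: $(\mathcal{A},+,\cdot)$ with $(\mathcal{A},+)$ an assembly (operators $e,s$), $\mathcal{N}=\{x:x=e(x)\}$, $(\mathcal{A}\setminus\mathcal{N},\cdot)$ an assembly (operators $u,d$), and for all $x,y,z$: (1) $xy+xz=x(y+z)+e(x)y+e(x)z$; (2) $\exists w\,(e(x)y=e(w))$; (3) $e(xy)=e(x)y+e(y)x$;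 (4) if $x\ne e(x)$ then $e(u(x))=e(x)d(x)$; (5) $s(xy)=s(x)y$. Ordered association: an association $(\mathcal{A},+,\cdot)$ with a total order $\le$ such that for all $x,y,z$: (1) $x\le y\Rightarrow x+z\le y+z$; (2) $y+e(x)=e(x)\Rightarrow (y\le e(x)\wedge s(y)\le e(x))$; (3) $(e(x)<x\wedge y\le z)\Rightarrow xy\le xz$; (4) $(e(y)\le y\le z)\Rightarrow e(x)y\le e(x)z$. -}

module Defs where

open import Level using (Level; _⊔_) renaming (suc to lsuc)
open import Data.Nat using (ℕ; zero; suc)
open import Data.Product using (Σ; ∃; _×_; _,_; proj₁; proj₂)
open import Data.Sum using (_⊎_)
open import Relation.Nullary using (¬_)
open import Relation.Binary.PropositionalEquality using (_≡_; _≢_)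
open import Relation.Binary.Structures using (IsTotalOrder; IsEquivalence)
open import Algebra.Structures using (IsCommutativeRing)

-- Ordered fields (with propositional equality on the carrier).
-- _⁻¹ is a total function; only its values at nonzero x are constrained.

record OrderedField (ℓ : Level) : Set (lsuc ℓ) where
  infixl 6 _+_
  infixl 7 _*_
  infix 4 _≤_
  infix 8 -_
  infix 9 _⁻¹
  field
    Carrier : Set ℓ
    _+_ _*_ : Carrier → Carrier → Carrier
    -_ : Carrier → Carrier
    _⁻¹ : Carrier → Carrier
    0# 1# : Carrier
    _≤_ : Carrier → Carrier → Set ℓ
    isCommutativeRing : IsCommutativeRing _≡_ _+_ _*_ -_ 0# 1#
    0≢1 : 0# ≢ 1#
    ⁻¹-inverse : ∀ x → x ≢ 0# → x * x ⁻¹ ≡ 1#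
    isTotalOrder : IsTotalOrder _≡_ _≤_
    +-mono-≤ : ∀ {x y} z → x ≤ y → x + z ≤ y + z
    *-nonneg : ∀ {x y} → 0# ≤ x → 0# ≤ y → 0# ≤ x * y

module _ {ℓ} (F : OrderedField ℓ) where
  open OrderedField F

  fromℕ : ℕ → Carrier
  fromℕ zero = 0#
  fromℕ (suc n) = 1# + fromℕ n

  Archimedean : Set ℓ
  Archimedean = ∀ x → ∃ λ (n : ℕ) → x ≤ fromℕ n

  NonArchimedean : Set ℓ
  NonArchimedean = ¬ Archimedean

  Subset : Set (lsuc ℓ)
  Subset = Carrier → Set ℓ

  record IsConvexSubgroup (S : Subset) : Set ℓ where
    field
      0∈ : S 0#
      +-closed : ∀ {x y} → S x → S y → S (x + y)
      neg-closed : ∀ {x} → S x → S (- x)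
      convex : ∀ {x y z} → S x → S y → x ≤ z → z ≤ y → S z

  _⊕_ : Subset → Subset → Subset
  (S ⊕ T) z = ∃ λ x → ∃ λ y → S x × T y × z ≡ x + y

  _⊗_ : Subset → Subset → Subset
  (S ⊗ T) z = ∃ λ x → ∃ λ y → S x × T y × z ≡ x * y

  _⊙_ : Carrier → Subset → Subset
  (a ⊙ S) z = ∃ λ x → S x × z ≡ a * x

  _⊘_ : Subset → Carrier → Subset
  (S ⊘ a) z = ∃ λ x → S x × z ≡ x * a ⁻¹

  -- A representative (a , A) stands for the coset a + A.
  Rep : Set (lsuc ℓ)
  Rep = Carrier × Subset

  _∈C_ : Carrier → Rep → Set ℓ
  x ∈C (a , A) = ∃ λ y → A y × x ≡ a + y

  InQ : Rep → Set ℓ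
  InQ (a , A) = IsConvexSubgroup A

  -- equality of elements of Q = equality of the cosets as subsets of F
  _≈Q_ : Rep → Rep → Set ℓ
  α ≈Q β = ∀ x → (x ∈C α → x ∈C β) × (x ∈C β → x ∈C α)

  _+Q_ : Rep → Rep → Rep
  (a , A) +Q (b , B) = (a + b , A ⊕ B)

  _·Q_ : Rep → Rep → Rep
  (a , A) ·Q (b , B) = (a * b , ((a ⊙ B) ⊕ (b ⊙ A)) ⊕ (A ⊗ B))

  eQ : Rep → Rep
  eQ (a , A) = (0# , A)

  sQ : Rep → Rep
  sQ (a , A) = (- a , A)

  uQ : Rep → Rep
  uQ (a , A) = (1# , A ⊘ a)

  dQ : Rep → Rep
  dQ (a , A) = (a ⁻¹ , A ⊘ (a * a))

  _≤Q_ : Rep → Rep → Set ℓ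
  α ≤Q β = ∀ x → x ∈C α → ∃ λ y → y ∈C β × x ≤ y

module _ {a b} {X : Set a} (_≈_ : X → X → Set b) where

  record IsAssemblyOn {c} (D : X → Set c) (_∗_ : X → X → X) (e s : X → X)
         : Set (a ⊔ b ⊔ c) where
    field
      isEquivalence : IsEquivalence _≈_
      nonempty : Σ X D
      ∗-closed : ∀ {x y} → D x → D y → D (x ∗ y)
      ∗-cong : ∀ {x x′ y y′} → D x → D x′ → D y → D y′ →
               x ≈ x′ → y ≈ y′ → (x ∗ y) ≈ (x′ ∗ y′)
      assoc : ∀ {x y z} → D x → D y → D z → ((x ∗ y) ∗ z) ≈ (x ∗ (y ∗ z))
      comm : ∀ {x y} → D x → D y → (x ∗ y) ≈ (y ∗ x)
      e-closed : ∀ {x} → D x → D (e x)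
      e-cong : ∀ {x y} → D x → D y → x ≈ y → e x ≈ e y
      e-neutral : ∀ {x} → D x → (x ∗ e x) ≈ x
      e-least : ∀ {x f} → D x → D f → (x ∗ f) ≈ x → (e x ∗ f) ≈ e x
      s-closed : ∀ {x} → D x → D (s x)
      s-cong : ∀ {x y} → D x → D y → x ≈ y → s x ≈ s y
      s-inverse : ∀ {x} → D x → (x ∗ s x) ≈ e x
      e-s : ∀ {x} → D x → e (s x) ≈ e x
      e-∗ : ∀ {x y} → D x → D y → (e (x ∗ y) ≈ e x) ⊎ (e (x ∗ y) ≈ e y)

  NotN : ∀ {c} → (X → Set c) → (X → X) → X → Set (b ⊔ c)
  NotN D e x = D x × ¬ (x ≈ e x)

  record IsAssociationOn {c} (D : X → Set c) (_+_ _·_ : X → X → X)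
         (e s u d : X → X) : Set (a ⊔ b ⊔ c) where
    field
      +-assembly : IsAssemblyOn D _+_ e s
      ·-closed : ∀ {x y} → D x → D y → D (x · y)
      ·-cong : ∀ {x x′ y y′} → D x → D x′ → D y → D y′ →
               x ≈ x′ → y ≈ y′ → (x · y) ≈ (x′ · y′)
      ·-assembly : IsAssemblyOn (NotN D e) _·_ u d
      distrib : ∀ {x y z} → D x → D y → D z →
                ((x · y) + (x · z)) ≈ (((x · (y + z)) + (e x · y)) + (e x · z))
      e·-is-e : ∀ {x y} → D x → D y → Σ X λ w → D w × ((e x · y) ≈ e w)
      e-· : ∀ {x y} → D x → D y → e (x · y) ≈ ((e x · y) + (e y · x))
      e-u : ∀ {x} → D x → ¬ (x ≈ e x) → e (u x) ≈ (e x · d x)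
      s-· : ∀ {x y} → D x → D y → s (x · y) ≈ (s x · y)

  record IsOrderedAssociationOn {c ℓ} (D : X → Set c) (_+_ _·_ : X → X → X)
         (e s u d : X → X) (_≤_ : X → X → Set ℓ) : Set (a ⊔ b ⊔ c ⊔ ℓ) where
    _<_ : X → X → Set (b ⊔ ℓ)
    x < y = (x ≤ y) × ¬ (x ≈ y)
    field
      isAssociation : IsAssociationOn D _+_ _·_ e s u d
      ≤-reflexive : ∀ {x y} → D x → D y → x ≈ y → x ≤ y
      ≤-trans : ∀ {x y z} → D x → D y → D z → x ≤ y → y ≤ z → x ≤ z
      ≤-antisym : ∀ {x y} → D x → D y → x ≤ y → y ≤ x → x ≈ y
      ≤-total : ∀ {x y} → D x → D y → (x ≤ y) ⊎ (y ≤ x)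
      +-mono : ∀ {x y z} → D x → D y → D z → x ≤ y → (x + z) ≤ (y + z)
      e-bound : ∀ {x y} → D x → D y → (y + e x) ≈ e x → (y ≤ e x) × (s y ≤ e x)
      ·-mono : ∀ {x y z} → D x → D y → D z → (e x < x) × (y ≤ z) → (x · y) ≤ (x · z)
      e·-mono : ∀ {x y z} → D x → D y → D z → (e y ≤ y) × (y ≤ z) → (e x · y) ≤ (e x · z)

module Submission where

open import Defs
open import Axiom.ExcludedMiddle using (ExcludedMiddle)
open import Data.Nat as ℕ using (zero; suc)
open import Data.Integer as ℤ using (ℤ; -[1+_])
import Data.Integer.Properties as ℤ
open import Data.Sign as Sign using (Sign)
open import Data.Product using (Σ; ∃; _×_; _,_; proj₁; proj₂)
open import Data.Sum using (_⊎_; inj₁; inj₂; [_,_]′)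
open import Data.Empty using (⊥; ⊥-elim)
open import Data.Maybe using (Maybe; just; nothing)
open import Relation.Nullary using (¬_; yes; no)
open import Relation.Binary.PropositionalEquality
open import Relation.Binary.Structures using (IsTotalOrder; IsEquivalence)
open import Algebra.Bundles using (CommutativeRing)
import Algebra.Solver.Ring.AlmostCommutativeRing as ACR

-- The proof rests on four
-- facts about convex subgroups, established first: they are exactly the
-- subsets containing 0 that are closed under doubling and absolutely convex;
-- an element outside a convex subgroup dominates it in absolute value; any
-- two of them are comparable under inclusion (classically); and they are
-- closed under the elementwise operations A + B, aB, AB and A/c.
-- Every identity between cosets is then reduced to the criterion
-- "a + A = b + B iff A = B and a - b ∈ A", with inclusions of subgroups
-- checked on generators.

-- The ring solver of the standard library needs a coefficient ring with a
-- (semi-)decidable equality mapping homomorphically into the target ring.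
-- The canonical map ℤ → F (n ↦ n·1) serves; constructing it only uses the
-- commutative-ring structure of F.
module IntegerCoefficients {ℓ} (F : OrderedField ℓ) where
  open OrderedField F using (Carrier; _+_; _*_; -_; 0#; 1#; isCommutativeRing)

  ring : CommutativeRing ℓ ℓ
  ring = record { isCommutativeRing = isCommutativeRing }

  open CommutativeRing ring using (+-identityˡ; +-identityʳ; *-identityˡ; zeroʳ; +-comm; -‿inverseʳ)
  open import Algebra.Properties.Ring (CommutativeRing.ring ring) using (-‿distribˡ-*; -‿involutive; -0#≈0#; -‿anti-homo-+)
  open import Algebra.Properties.Semiring.Mult.TCOptimised (CommutativeRing.semiring ring) using (×-homo-+; ×1-homo-*) renaming (_×_ to _×ₙ_)
  open import Algebra.Properties.CommutativeSemigroup (CommutativeRing.*-commutativeSemigroup ring) using (interchange)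
  open import Algebra.Properties.CommutativeSemigroup (CommutativeRing.+-commutativeSemigroup ring) using () renaming (interchange to +-interchange)
  open ≡-Reasoning

  ⟦_⟧ₛ : Sign → Carrier
  ⟦ Sign.+ ⟧ₛ = 1#
  ⟦ Sign.- ⟧ₛ = - 1#

  ⟦_⟧ : ℤ → Carrier
  ⟦ ℤ.+ n ⟧ = n ×ₙ 1#
  ⟦ -[1+ n ] ⟧ = - (suc n ×ₙ 1#)

  -1*x≡-x : ∀ x → - 1# * x ≡ - x
  -1*x≡-x x = trans (sym (-‿distribˡ-* 1# x)) (cong -_ (*-identityˡ x))

  ⟦⟧ₛ-homo : ∀ s t → ⟦ s Sign.* t ⟧ₛ ≡ ⟦ s ⟧ₛ * ⟦ t ⟧ₛ
  ⟦⟧ₛ-homo Sign.+ t = sym (*-identityˡ _)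
  ⟦⟧ₛ-homo Sign.- Sign.+ = sym (-1*x≡-x 1#)
  ⟦⟧ₛ-homo Sign.- Sign.- = sym (trans (-1*x≡-x (- 1#)) (-‿involutive 1#))

  ⟦◃⟧ : ∀ s n → ⟦ s ℤ.◃ n ⟧ ≡ ⟦ s ⟧ₛ * (n ×ₙ 1#)
  ⟦◃⟧ s zero = sym (zeroʳ ⟦ s ⟧ₛ)
  ⟦◃⟧ Sign.+ (suc n) = sym (*-identityˡ _)
  ⟦◃⟧ Sign.- (suc n) = sym (-1*x≡-x _)

  ⟦⟧-sign-abs : ∀ i → ⟦ i ⟧ ≡ ⟦ ℤ.sign i ⟧ₛ * (ℤ.∣ i ∣ ×ₙ 1#)
  ⟦⟧-sign-abs i = trans (cong ⟦_⟧ (sym (ℤ.◃-inverse i))) (⟦◃⟧ (ℤ.sign i) ℤ.∣ i ∣)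

  *-homo : ∀ i j → ⟦ i ℤ.* j ⟧ ≡ ⟦ i ⟧ * ⟦ j ⟧
  *-homo i j = begin
    ⟦ i ℤ.* j ⟧                                ≡⟨ ⟦◃⟧ (s Sign.* t) (m ℕ.* n) ⟩
    ⟦ s Sign.* t ⟧ₛ * ((m ℕ.* n) ×ₙ 1#)         ≡⟨ cong₂ _*_ (⟦⟧ₛ-homo s t) (×1-homo-* m n) ⟩
    (⟦ s ⟧ₛ * ⟦ t ⟧ₛ) * ((m ×ₙ 1#) * (n ×ₙ 1#))  ≡⟨ interchange ⟦ s ⟧ₛ ⟦ t ⟧ₛ (m ×ₙ 1#) (n ×ₙ 1#) ⟩
    (⟦ s ⟧ₛ * (m ×ₙ 1#)) * (⟦ t ⟧ₛ * (n ×ₙ 1#))  ≡⟨ sym (cong₂ _*_ (⟦⟧-sign-abs i) (⟦⟧-sign-abs j)) ⟩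
    ⟦ i ⟧ * ⟦ j ⟧                              ∎
    where
    s = ℤ.sign i
    t = ℤ.sign j
    m = ℤ.∣ i ∣
    n = ℤ.∣ j ∣

  ⟦⊖⟧ : ∀ m n → ⟦ m ℤ.⊖ n ⟧ ≡ m ×ₙ 1# + - (n ×ₙ 1#)
  ⟦⊖⟧ m zero = trans (cong ⟦_⟧ (ℤ.⊖-≥ {m} {0} ℕ.z≤n)) (sym (trans (cong ((m ×ₙ 1#) +_) -0#≈0#) (+-identityʳ _)))
  ⟦⊖⟧ zero (suc n) = trans (cong ⟦_⟧ (ℤ.⊖-< {0} {suc n} (ℕ.s≤s ℕ.z≤n))) (sym (+-identityˡ _))
  ⟦⊖⟧ (suc m) (suc n) = begin
    ⟦ suc m ℤ.⊖ suc n ⟧                         ≡⟨ cong ⟦_⟧ (ℤ.[1+m]⊖[1+n]≡m⊖n m n) ⟩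
    ⟦ m ℤ.⊖ n ⟧                                 ≡⟨ ⟦⊖⟧ m n ⟩
    m ×ₙ 1# + - (n ×ₙ 1#)                         ≡⟨ sym (cancel (m ×ₙ 1#) (n ×ₙ 1#)) ⟩
    (1# + m ×ₙ 1#) + - (1# + n ×ₙ 1#)             ≡⟨ sym (cong₂ (λ u v → u + - v) (×-homo-+ 1# 1 m) (×-homo-+ 1# 1 n)) ⟩
    suc m ×ₙ 1# + - (suc n ×ₙ 1#)                 ∎
    where
    cancel : ∀ x y → (1# + x) + - (1# + y) ≡ x + - y
    cancel x y = begin
      (1# + x) + - (1# + y)     ≡⟨ cong ((1# + x) +_) (trans (-‿anti-homo-+ 1# y) (+-comm (- y) (- 1#))) ⟩
      (1# + x) + (- 1# + - y)   ≡⟨ +-interchange 1# x (- 1#) (- y) ⟩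
      (1# + - 1#) + (x + - y)   ≡⟨ cong (_+ (x + - y)) (-‿inverseʳ 1#) ⟩
      0# + (x + - y)            ≡⟨ +-identityˡ _ ⟩
      x + - y                   ∎

  +-homo : ∀ i j → ⟦ i ℤ.+ j ⟧ ≡ ⟦ i ⟧ + ⟦ j ⟧
  +-homo (ℤ.+ m) (ℤ.+ n) = ×-homo-+ 1# m n
  +-homo (ℤ.+ m) -[1+ n ] = ⟦⊖⟧ m (suc n)
  +-homo -[1+ m ] (ℤ.+ n) = trans (⟦⊖⟧ n (suc m)) (+-comm _ _)
  +-homo -[1+ m ] -[1+ n ] = begin
    - ((suc (suc (m ℕ.+ n))) ×ₙ 1#)            ≡⟨ cong -_ (trans (cong (λ k → k ×ₙ 1#) (cong suc (sym (ℕP.+-suc m n)))) (×-homo-+ 1# (suc m) (suc n))) ⟩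
    - (suc m ×ₙ 1# + suc n ×ₙ 1#)               ≡⟨ trans (-‿anti-homo-+ _ _) (+-comm _ _) ⟩
    - (suc m ×ₙ 1#) + - (suc n ×ₙ 1#)           ∎
    where import Data.Nat.Properties as ℕP

  -‿homo : ∀ i → ⟦ ℤ.- i ⟧ ≡ - ⟦ i ⟧
  -‿homo (ℤ.+ zero) = sym -0#≈0#
  -‿homo ℤ.+[1+ n ] = refl
  -‿homo -[1+ n ] = sym (-‿involutive _)

  homomorphism : ACR._-Raw-AlmostCommutative⟶_ ℤ.+-*-rawRing (ACR.fromCommutativeRing ring)
  homomorphism = record
    { ⟦_⟧ = ⟦_⟧ ; +-homo = +-homo ; *-homo = *-homo ; -‿homo = -‿homo
    ; 0-homo = refl ; 1-homo = refl }

  -- equal integers have equal images (all the solver needs)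
  image-equal? : ∀ i j → Maybe (⟦ i ⟧ ≡ ⟦ j ⟧)
  image-equal? i j with i ℤ.≟ j
  ... | yes i≡j = just (cong ⟦_⟧ i≡j)
  ... | no _ = nothing

  open import Algebra.Solver.Ring ℤ.+-*-rawRing (ACR.fromCommutativeRing ring) homomorphism image-equal? public
    using (solve; _:=_; _:+_; _:*_; :-_; _:-_; Polynomial; con)

  :0 :1 : ∀ {n} → Polynomial n
  :0 = con (ℤ.+ 0)
  :1 = con (ℤ.+ 1)

module OrderedFieldFacts {ℓ} (F : OrderedField ℓ) where
  open OrderedField F
  open IntegerCoefficients F public using (ring; solve; _:=_; _:+_; _:*_; :-_; _:-_; :0; :1)
  open CommutativeRing ring public using (+-identityˡ; +-identityʳ; *-identityˡ; *-identityʳ; zeroˡ; zeroʳ; +-comm; *-comm)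
  open IsTotalOrder isTotalOrder public using (total; antisym) renaming (refl to ≤-refl; trans to ≤-trans)
  open ≡-Reasoning

  infixl 6 _-_
  _-_ : Carrier → Carrier → Carrier
  x - y = x + - y

  ≤-resp : ∀ {x x′ y y′} → x ≡ x′ → y ≡ y′ → x ≤ y → x′ ≤ y′
  ≤-resp refl refl x≤y = x≤y

  ≤-reflexive : ∀ {x y} → x ≡ y → x ≤ y
  ≤-reflexive refl = ≤-refl

  +-monoʳ-≤ : ∀ {x y} z → x ≤ y → z + x ≤ z + y
  +-monoʳ-≤ {x} {y} z x≤y = ≤-resp (+-comm x z) (+-comm y z) (+-mono-≤ z x≤y)

  +-mono₂-≤ : ∀ {x y u v} → x ≤ y → u ≤ v → x + u ≤ y + v
  +-mono₂-≤ {y = y} {u} x≤y u≤v = ≤-trans (+-mono-≤ u x≤y) (+-monoʳ-≤ y u≤v)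

  +-cancelˡ-≤ : ∀ {x y} z → z + x ≤ z + y → x ≤ y
  +-cancelˡ-≤ {x} {y} z p =
    ≤-resp (solve 2 (λ z x → :- z :+ (z :+ x) := x) refl z x) (solve 2 (λ z y → :- z :+ (z :+ y) := y) refl z y)
      (+-monoʳ-≤ (- z) p)

  x≤y⇒0≤y-x : ∀ {x y} → x ≤ y → 0# ≤ y - x
  x≤y⇒0≤y-x {x} p = ≤-resp (solve 1 (λ x → x :- x := :0) refl x) refl (+-mono-≤ (- x) p)

  0≤y-x⇒x≤y : ∀ {x y} → 0# ≤ y - x → x ≤ y
  0≤y-x⇒x≤y {x} {y} p = ≤-resp (+-identityˡ x) (solve 2 (λ x y → (y :- x) :+ x := y) refl x y) (+-mono-≤ x p)

  neg-anti-≤ : ∀ {x y} → x ≤ y → - y ≤ - x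
  neg-anti-≤ {x} {y} p = 0≤y-x⇒x≤y (≤-resp refl (solve 2 (λ x y → y :- x := :- x :- (:- y)) refl x y) (x≤y⇒0≤y-x p))

  neg-0# : - 0# ≡ 0#
  neg-0# = solve 0 (:- :0 := :0) refl

  neg-involutive : ∀ x → - (- x) ≡ x
  neg-involutive = solve 1 (λ x → :- (:- x) := x) refl

  x≤0⇒0≤-x : ∀ {x} → x ≤ 0# → 0# ≤ - x
  x≤0⇒0≤-x p = ≤-resp neg-0# refl (neg-anti-≤ p)

  0≤x⇒-x≤0 : ∀ {x} → 0# ≤ x → - x ≤ 0#
  0≤x⇒-x≤0 p = ≤-resp refl neg-0# (neg-anti-≤ p)

  -x≤y⇒-y≤x : ∀ {x y} → - x ≤ y → - y ≤ x
  -x≤y⇒-y≤x {x} p = ≤-resp refl (neg-involutive x) (neg-anti-≤ p)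

  0≤1 : 0# ≤ 1#
  0≤1 with total 0# 1#
  ... | inj₁ 0≤1′ = 0≤1′
  ... | inj₂ 1≤0 = ⊥-elim (0≢1 (antisym 0≤1′ 1≤0))
    where
    -- (-1)·(-1) = 1 is a square, hence nonnegative
    0≤1′ : 0# ≤ 1#
    0≤1′ = ≤-resp refl (solve 0 (:- :1 :* :- :1 := :1) refl)
            (*-nonneg (x≤0⇒0≤-x 1≤0) (x≤0⇒0≤-x 1≤0))

  *-monoˡ-≤ : ∀ {c x y} → 0# ≤ c → x ≤ y → c * x ≤ c * y
  *-monoˡ-≤ {c} {x} {y} 0≤c x≤y = 0≤y-x⇒x≤y
    (≤-resp refl (solve 3 (λ c x y → c :* (y :- x) := c :* y :- c :* x) refl c x y) (*-nonneg 0≤c (x≤y⇒0≤y-x x≤y)))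

  *-monoʳ-≤ : ∀ {c x y} → 0# ≤ c → x ≤ y → x * c ≤ y * c
  *-monoʳ-≤ {c} {x} {y} 0≤c x≤y = ≤-resp (*-comm c x) (*-comm c y) (*-monoˡ-≤ 0≤c x≤y)

  ∣_∣ : Carrier → Carrier
  ∣ x ∣ with total 0# x
  ... | inj₁ _ = x
  ... | inj₂ _ = - x

  data AbsView (x : Carrier) : Carrier → Set ℓ where
    nonneg : 0# ≤ x → AbsView x x
    nonpos : x ≤ 0# → AbsView x (- x)

  abs-view : ∀ x → AbsView x ∣ x ∣
  abs-view x with total 0# x
  ... | inj₁ 0≤x = nonneg 0≤x
  ... | inj₂ x≤0 = nonpos x≤0

  ∣x∣≡x : ∀ {x} → 0# ≤ x → ∣ x ∣ ≡ x
  ∣x∣≡x {x} 0≤x with ∣ x ∣ | abs-view x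
  ... | _ | nonneg _ = refl
  ... | _ | nonpos x≤0 = trans (cong -_ x≡0) (trans neg-0# (sym x≡0))
    where x≡0 = antisym x≤0 0≤x

  0≤∣x∣ : ∀ x → 0# ≤ ∣ x ∣
  0≤∣x∣ x with ∣ x ∣ | abs-view x
  ... | _ | nonneg 0≤x = 0≤x
  ... | _ | nonpos x≤0 = x≤0⇒0≤-x x≤0

  x≤∣x∣ : ∀ x → x ≤ ∣ x ∣
  x≤∣x∣ x with ∣ x ∣ | abs-view x
  ... | _ | nonneg _ = ≤-refl
  ... | _ | nonpos x≤0 = ≤-trans x≤0 (x≤0⇒0≤-x x≤0)

  -x≤∣x∣ : ∀ x → - x ≤ ∣ x ∣
  -x≤∣x∣ x with ∣ x ∣ | abs-view x
  ... | _ | nonneg 0≤x = ≤-trans (0≤x⇒-x≤0 0≤x) 0≤x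
  ... | _ | nonpos _ = ≤-refl

  ∣x∣≤-intro : ∀ {x c} → x ≤ c → - x ≤ c → ∣ x ∣ ≤ c
  ∣x∣≤-intro {x} x≤c -x≤c with ∣ x ∣ | abs-view x
  ... | _ | nonneg _ = x≤c
  ... | _ | nonpos _ = -x≤c

  ∣-x∣≡∣x∣ : ∀ x → ∣ - x ∣ ≡ ∣ x ∣
  ∣-x∣≡∣x∣ x = antisym (∣x∣≤-intro (-x≤∣x∣ x) (≤-resp (sym (neg-involutive x)) refl (x≤∣x∣ x)))
                       (∣x∣≤-intro (≤-resp (neg-involutive x) refl (-x≤∣x∣ (- x))) (x≤∣x∣ (- x)))

  ∣x∣≤0⇒x≡0 : ∀ {x} → ∣ x ∣ ≤ 0# → x ≡ 0#
  ∣x∣≤0⇒x≡0 {x} p = antisym (≤-trans (x≤∣x∣ x) p) (≤-resp neg-0# refl (-x≤y⇒-y≤x (≤-trans (-x≤∣x∣ x) p)))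

  0≤x+x : ∀ {x} → 0# ≤ x → 0# ≤ x + x
  0≤x+x 0≤x = ≤-resp (+-identityˡ 0#) refl (+-mono₂-≤ 0≤x 0≤x)

  triangle : ∀ x y → ∣ x + y ∣ ≤ ∣ x ∣ + ∣ y ∣
  triangle x y = ∣x∣≤-intro (+-mono₂-≤ (x≤∣x∣ x) (x≤∣x∣ y))
    (≤-resp (solve 2 (λ x y → :- x :+ :- y := :- (x :+ y)) refl x y) refl (+-mono₂-≤ (-x≤∣x∣ x) (-x≤∣x∣ y)))

  ∣z∣≡-z : ∀ {z w} → 0# ≤ w → w ≡ - z → ∣ z ∣ ≡ w
  ∣z∣≡-z {z} 0≤w refl = trans (sym (∣-x∣≡∣x∣ z)) (∣x∣≡x 0≤w)

  ∣x*y∣≡∣x∣*∣y∣ : ∀ x y → ∣ x * y ∣ ≡ ∣ x ∣ * ∣ y ∣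
  ∣x*y∣≡∣x∣*∣y∣ x y with ∣ x ∣ | abs-view x | ∣ y ∣ | abs-view y
  ... | _ | nonneg 0≤x | _ | nonneg 0≤y = ∣x∣≡x (*-nonneg 0≤x 0≤y)
  ... | _ | nonneg 0≤x | _ | nonpos y≤0 =
    ∣z∣≡-z (*-nonneg 0≤x (x≤0⇒0≤-x y≤0)) (solve 2 (λ x y → x :* :- y := :- (x :* y)) refl x y)
  ... | _ | nonpos x≤0 | _ | nonneg 0≤y =
    ∣z∣≡-z (*-nonneg (x≤0⇒0≤-x x≤0) 0≤y) (solve 2 (λ x y → :- x :* y := :- (x :* y)) refl x y)
  ... | _ | nonpos x≤0 | _ | nonpos y≤0 =
    trans (cong ∣_∣ (solve 2 (λ x y → x :* y := :- x :* :- y) refl x y)) (∣x∣≡x (*-nonneg (x≤0⇒0≤-x x≤0) (x≤0⇒0≤-x y≤0)))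

  x⁻¹*x≡1 : ∀ {x} → x ≢ 0# → x ⁻¹ * x ≡ 1#
  x⁻¹*x≡1 {x} x≢0 = trans (*-comm _ x) (⁻¹-inverse x x≢0)

  cancelˡ : ∀ {a} z → a ≢ 0# → a * (a ⁻¹ * z) ≡ z
  cancelˡ {a} z a≢0 = begin
    a * (a ⁻¹ * z)  ≡⟨ solve 3 (λ a i z → a :* (i :* z) := a :* i :* z) refl a (a ⁻¹) z ⟩
    a * a ⁻¹ * z    ≡⟨ cong (_* z) (⁻¹-inverse a a≢0) ⟩
    1# * z          ≡⟨ *-identityˡ z ⟩
    z               ∎

  cancelʳ : ∀ {a} z → a ≢ 0# → a * (z * a ⁻¹) ≡ z
  cancelʳ {a} z a≢0 = trans (cong (a *_) (*-comm z (a ⁻¹))) (cancelˡ z a≢0)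

  *-nonzero : ∀ {x y} → x ≢ 0# → y ≢ 0# → x * y ≢ 0#
  *-nonzero {x} {y} x≢0 y≢0 xy≡0 = y≢0 (begin
    y               ≡⟨ sym (cancelˡ y x≢0) ⟩
    x * (x ⁻¹ * y)  ≡⟨ solve 3 (λ x i y → x :* (i :* y) := i :* (x :* y)) refl x (x ⁻¹) y ⟩
    x ⁻¹ * (x * y)  ≡⟨ cong (x ⁻¹ *_) xy≡0 ⟩
    x ⁻¹ * 0#       ≡⟨ zeroʳ _ ⟩
    0#              ∎)

  ⁻¹-unique : ∀ {c z} → c ≢ 0# → c * z ≡ 1# → z ≡ c ⁻¹
  ⁻¹-unique {c} {z} c≢0 cz≡1 = begin
    z               ≡⟨ sym (cancelˡ z c≢0) ⟩
    c * (c ⁻¹ * z)  ≡⟨ solve 3 (λ c i z → c :* (i :* z) := i :* (c :* z)) refl c (c ⁻¹) z ⟩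
    c ⁻¹ * (c * z)  ≡⟨ cong (c ⁻¹ *_) cz≡1 ⟩
    c ⁻¹ * 1#       ≡⟨ *-identityʳ _ ⟩
    c ⁻¹            ∎

  ⁻¹-involutive : ∀ {x} → x ≢ 0# → (x ⁻¹) ⁻¹ ≡ x
  ⁻¹-involutive {x} x≢0 = sym (⁻¹-unique x⁻¹≢0 (x⁻¹*x≡1 x≢0))
    where
    x⁻¹≢0 : x ⁻¹ ≢ 0#
    x⁻¹≢0 x⁻¹≡0 = 0≢1 (trans (sym (zeroʳ x)) (trans (cong (x *_) (sym x⁻¹≡0)) (⁻¹-inverse x x≢0)))

  ⁻¹-*-homo : ∀ {x y} → x ≢ 0# → y ≢ 0# → (x * y) ⁻¹ ≡ x ⁻¹ * y ⁻¹
  ⁻¹-*-homo {x} {y} x≢0 y≢0 = sym (⁻¹-unique (*-nonzero x≢0 y≢0) (begin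
    (x * y) * (x ⁻¹ * y ⁻¹)  ≡⟨ solve 4 (λ x y i j → (x :* y) :* (i :* j) := (x :* i) :* (y :* j)) refl x y (x ⁻¹) (y ⁻¹) ⟩
    (x * x ⁻¹) * (y * y ⁻¹)  ≡⟨ cong₂ _*_ (⁻¹-inverse x x≢0) (⁻¹-inverse y y≢0) ⟩
    1# * 1#                  ≡⟨ *-identityˡ 1# ⟩
    1#                       ∎))

  ∣x⁻¹∣*∣x∣≡1 : ∀ {x} → x ≢ 0# → ∣ x ⁻¹ ∣ * ∣ x ∣ ≡ 1#
  ∣x⁻¹∣*∣x∣≡1 {x} x≢0 = trans (sym (∣x*y∣≡∣x∣*∣y∣ (x ⁻¹) x)) (trans (cong ∣_∣ (x⁻¹*x≡1 x≢0)) (∣x∣≡x 0≤1))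

  scale-≤ : ∀ {x y} k → ∣ x ∣ ≤ y → ∣ x * k ∣ ≤ y * ∣ k ∣
  scale-≤ {x} k p = ≤-resp (sym (∣x*y∣≡∣x∣*∣y∣ x k)) refl (*-monoʳ-≤ (0≤∣x∣ k) p)

  divide-≤ : ∀ {c z y} → c ≢ 0# → ∣ z ∣ ≤ ∣ c * y ∣ → ∣ c ⁻¹ * z ∣ ≤ ∣ y ∣
  divide-≤ {c} {z} {y} c≢0 p = ≤-resp (cong ∣_∣ (*-comm z (c ⁻¹))) (begin
    ∣ c * y ∣ * ∣ c ⁻¹ ∣       ≡⟨ cong (_* ∣ c ⁻¹ ∣) (∣x*y∣≡∣x∣*∣y∣ c y) ⟩
    ∣ c ∣ * ∣ y ∣ * ∣ c ⁻¹ ∣   ≡⟨ solve 3 (λ a b i → a :* b :* i := (i :* a) :* b) refl (∣ c ∣) (∣ y ∣) (∣ c ⁻¹ ∣) ⟩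
    ∣ c ⁻¹ ∣ * ∣ c ∣ * ∣ y ∣   ≡⟨ cong (_* ∣ y ∣) (∣x⁻¹∣*∣x∣≡1 c≢0) ⟩
    1# * ∣ y ∣                 ≡⟨ *-identityˡ _ ⟩
    ∣ y ∣                      ∎) (scale-≤ (c ⁻¹) p)

  ratio-≤1 : ∀ {y b} → b ≢ 0# → ∣ y ∣ ≤ ∣ b ∣ → ∣ y * b ⁻¹ ∣ ≤ 1#
  ratio-≤1 {y} {b} b≢0 p = ≤-resp refl (trans (*-comm ∣ b ∣ _) (∣x⁻¹∣*∣x∣≡1 b≢0)) (scale-≤ (b ⁻¹) p)

  ratio-≤2 : ∀ {y b} → b ≢ 0# → ∣ y ∣ ≤ ∣ b ∣ + ∣ b ∣ → ∣ y * b ⁻¹ ∣ ≤ 1# + 1#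
  ratio-≤2 {y} {b} b≢0 p = ≤-resp refl (begin
    (∣ b ∣ + ∣ b ∣) * ∣ b ⁻¹ ∣              ≡⟨ solve 2 (λ u v → (u :+ u) :* v := v :* u :+ v :* u) refl (∣ b ∣) (∣ b ⁻¹ ∣) ⟩
    ∣ b ⁻¹ ∣ * ∣ b ∣ + ∣ b ⁻¹ ∣ * ∣ b ∣     ≡⟨ cong₂ _+_ (∣x⁻¹∣*∣x∣≡1 b≢0) (∣x⁻¹∣*∣x∣≡1 b≢0) ⟩
    1# + 1#                                  ∎) (scale-≤ (b ⁻¹) p)

  contract-≤ : ∀ {x r} → ∣ r ∣ ≤ 1# → ∣ x * r ∣ ≤ ∣ x ∣
  contract-≤ {x} {r} p = ≤-resp (sym (∣x*y∣≡∣x∣*∣y∣ x r)) (*-identityʳ ∣ x ∣) (*-monoˡ-≤ (0≤∣x∣ x) p)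

module ConvexSubgroups {ℓ} (F : OrderedField ℓ) (em : ExcludedMiddle ℓ) where
  open OrderedField F
  open OrderedFieldFacts F

  IsCSG : Subset F → Set ℓ
  IsCSG = IsConvexSubgroup F

  infix 4 _⊆_
  _⊆_ : Subset F → Subset F → Set ℓ
  S ⊆ T = ∀ {x} → S x → T x

  infixl 6 _⊕ˢ_
  infixl 7 _⊗ˢ_ _⊘ˢ_
  infixr 7 _⊙ˢ_
  _⊕ˢ_ _⊗ˢ_ : Subset F → Subset F → Subset F
  _⊕ˢ_ = _⊕_ F
  _⊗ˢ_ = _⊗_ F
  _⊙ˢ_ : Carrier → Subset F → Subset F
  _⊙ˢ_ = _⊙_ F
  _⊘ˢ_ : Subset F → Carrier → Subset F
  _⊘ˢ_ = _⊘_ F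

  module CSG {S : Subset F} (cs : IsCSG S) where
    open IsConvexSubgroup cs public

    ∈-resp : ∀ {x y} → S x → x ≡ y → S y
    ∈-resp sx refl = sx

    0≡-closed : ∀ {y} → 0# ≡ y → S y
    0≡-closed = ∈-resp 0∈

    0*-closed : ∀ {x} → S (0# * x)
    0*-closed {x} = 0≡-closed (sym (zeroˡ x))

    sub-closed : ∀ {x y} → S x → S y → S (x - y)
    sub-closed sx sy = +-closed sx (neg-closed sy)

    swap-closed : ∀ {x y} → S (x - y) → S (y - x)
    swap-closed {x} {y} s = ∈-resp (neg-closed s) (solve 2 (λ x y → :- (x :- y) := y :- x) refl x y)

    sum₂-closed : ∀ {x y w} → S x → S y → x + y ≡ w → S w
    sum₂-closed sx sy = ∈-resp (+-closed sx sy)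

    sum₃-closed : ∀ {x y z w} → S x → S y → S z → x + y + z ≡ w → S w
    sum₃-closed sx sy sz = ∈-resp (+-closed (+-closed sx sy) sz)

    double-closed : ∀ {x} → S x → S (x + x)
    double-closed s = +-closed s s

    ∣∣-closed : ∀ {x} → S x → S ∣ x ∣
    ∣∣-closed {x} sx with ∣ x ∣ | abs-view x
    ... | _ | nonneg _ = sx
    ... | _ | nonpos _ = neg-closed sx

    ∣∣-down : ∀ {x y} → S y → ∣ x ∣ ≤ ∣ y ∣ → S x
    ∣∣-down {x} {y} sy p = convex (neg-closed (∣∣-closed sy)) (∣∣-closed sy)
      (-x≤y⇒-y≤x (≤-trans (-x≤∣x∣ x) p)) (≤-trans (x≤∣x∣ x) p)

    outside-dominates : ∀ {d α} → ¬ S d → S α → ∣ α ∣ ≤ ∣ d ∣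
    outside-dominates {d} {α} d∉S α∈S with total ∣ α ∣ ∣ d ∣
    ... | inj₁ p = p
    ... | inj₂ p = ⊥-elim (d∉S (∣∣-down α∈S p))

    outside-nonzero : ∀ {d} → ¬ S d → d ≢ 0#
    outside-nonzero d∉S refl = d∉S 0∈

  convexSubgroup-intro : ∀ {S : Subset F} → S 0# → (∀ {x} → S x → S (x + x)) →
                         (∀ {x y} → S y → ∣ x ∣ ≤ ∣ y ∣ → S x) → IsCSG S
  convexSubgroup-intro {S} 0∈S double down = record
    { 0∈ = 0∈S
    ; +-closed = +-closed
    ; neg-closed = λ {x} sx → down sx (≤-reflexive (∣-x∣≡∣x∣ x))
    ; convex = convex }
    where
    below-double : ∀ {x u y} → S y → ∣ x ∣ ≤ ∣ y ∣ → ∣ u ∣ ≤ ∣ y ∣ → S (x + u)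
    below-double {x} {u} {y} sy p q = down (double (down sy (≤-reflexive (∣x∣≡x (0≤∣x∣ y)))))
      (≤-trans (triangle x u) (≤-resp refl (sym (∣x∣≡x (0≤x+x (0≤∣x∣ y)))) (+-mono₂-≤ p q)))
    +-closed : ∀ {x y} → S x → S y → S (x + y)
    +-closed {x} {y} sx sy with total ∣ x ∣ ∣ y ∣
    ... | inj₁ p = below-double sy p ≤-refl
    ... | inj₂ p = below-double sx ≤-refl p
    convex : ∀ {x y z} → S x → S y → x ≤ z → z ≤ y → S z
    -- ∣ z ∣ is bounded by the larger of ∣ x ∣ and ∣ y ∣
    convex {x} {y} {z} sx sy x≤z z≤y with total ∣ x ∣ ∣ y ∣
    ... | inj₁ p = down sy (∣x∣≤-intro (≤-trans z≤y (x≤∣x∣ y)) (≤-trans (neg-anti-≤ x≤z) (≤-trans (-x≤∣x∣ x) p)))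
    ... | inj₂ p = down sx (∣x∣≤-intro (≤-trans z≤y (≤-trans (x≤∣x∣ y) p)) (≤-trans (neg-anti-≤ x≤z) (-x≤∣x∣ x)))

  ⊆-total : ∀ {A B} → IsCSG A → IsCSG B → (A ⊆ B) ⊎ (B ⊆ A)
  ⊆-total {A} {B} ca cb with em {∃ λ x → A x × ¬ B x}
  ... | yes (x , x∈A , x∉B) = inj₂ (λ y∈B → CSG.∣∣-down ca x∈A (CSG.outside-dominates cb x∉B y∈B))
  ... | no ∄ = inj₁ A⊆B
    where
    A⊆B : A ⊆ B
    A⊆B {x} x∈A with em {B x}
    ... | yes x∈B = x∈B
    ... | no x∉B = ⊥-elim (∄ (x , x∈A , x∉B))

  IsCSG-resp : ∀ {S T} → S ⊆ T → T ⊆ S → IsCSG S → IsCSG T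
  IsCSG-resp S⊆T T⊆S cs = record
    { 0∈ = S⊆T 0∈
    ; +-closed = λ x y → S⊆T (+-closed (T⊆S x) (T⊆S y))
    ; neg-closed = λ x → S⊆T (neg-closed (T⊆S x))
    ; convex = λ x y p q → S⊆T (convex (T⊆S x) (T⊆S y) p q) }
    where open IsConvexSubgroup cs

  infix 4 _≐_
  _≐_ : Subset F → Subset F → Set ℓ
  S ≐ T = (S ⊆ T) × (T ⊆ S)

  ⊕-intro : ∀ {A B x y} → A x → B y → (A ⊕ˢ B) (x + y)
  ⊕-intro {x = x} {y} ax by = x , y , ax , by , refl

  ⊕-inl : ∀ {A B} → IsCSG B → A ⊆ A ⊕ˢ B
  ⊕-inl cb {x} ax = x , 0# , ax , CSG.0∈ cb , sym (+-identityʳ x)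

  ⊕-inr : ∀ {A B} → IsCSG A → B ⊆ A ⊕ˢ B
  ⊕-inr ca {x} bx = 0# , x , CSG.0∈ ca , bx , sym (+-identityˡ x)

  ⊕-lub : ∀ {A B C} → IsCSG C → A ⊆ C → B ⊆ C → A ⊕ˢ B ⊆ C
  ⊕-lub cc A⊆C B⊆C (x , y , ax , by , refl) = CSG.+-closed cc (A⊆C ax) (B⊆C by)

  ⊕-mono : ∀ {A B A′ B′} → A ⊆ A′ → B ⊆ B′ → A ⊕ˢ B ⊆ A′ ⊕ˢ B′
  ⊕-mono f g (x , y , ax , by , e) = x , y , f ax , g by , e

  ⊕-max : ∀ {A B} → IsCSG A → IsCSG B → (A ⊕ˢ B ≐ A) ⊎ (A ⊕ˢ B ≐ B)
  ⊕-max ca cb with ⊆-total ca cb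
  ... | inj₁ A⊆B = inj₂ (⊕-lub cb A⊆B (λ b → b) , ⊕-inr ca)
  ... | inj₂ B⊆A = inj₁ (⊕-lub ca (λ a → a) B⊆A , ⊕-inl cb)

  ⊕-CSG : ∀ {A B} → IsCSG A → IsCSG B → IsCSG (A ⊕ˢ B)
  ⊕-CSG ca cb with ⊕-max ca cb
  ... | inj₁ (p , q) = IsCSG-resp q p ca
  ... | inj₂ (p , q) = IsCSG-resp q p cb

  ≐-refl : ∀ {S} → S ≐ S
  ≐-refl = (λ x → x) , (λ x → x)

  ⊕-idem : ∀ {A} → IsCSG A → A ⊕ˢ A ≐ A
  ⊕-idem ca = ⊕-lub ca (λ x → x) (λ x → x) , ⊕-inl ca

  ⊕-comm : ∀ {A B} → IsCSG A → IsCSG B → A ⊕ˢ B ≐ B ⊕ˢ A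
  ⊕-comm ca cb = ⊕-lub (⊕-CSG cb ca) (⊕-inr cb) (⊕-inl ca) , ⊕-lub (⊕-CSG ca cb) (⊕-inr ca) (⊕-inl cb)

  ⊕-assoc : ∀ {A B C} → IsCSG A → IsCSG B → IsCSG C → (A ⊕ˢ B) ⊕ˢ C ≐ A ⊕ˢ (B ⊕ˢ C)
  ⊕-assoc ca cb cc =
    ⊕-lub cR (⊕-lub cR (⊕-inl cbc) (λ b → ⊕-inr ca (⊕-inl cc b))) (λ c → ⊕-inr ca (⊕-inr cb c)) ,
    ⊕-lub cL (λ a → ⊕-inl cc (⊕-inl cb a)) (⊕-lub cL (λ b → ⊕-inl cc (⊕-inr ca b)) (⊕-inr cab))
    where
    cab = ⊕-CSG ca cb
    cbc = ⊕-CSG cb cc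
    cL = ⊕-CSG cab cc
    cR = ⊕-CSG ca cbc

  ⊙-CSG : ∀ {B} a → IsCSG B → IsCSG (a ⊙ˢ B)
  ⊙-CSG {B} a cb = convexSubgroup-intro (0# , 0∈ , sym (zeroʳ a)) double down
    where
    open CSG cb
    double : ∀ {x} → (a ⊙ˢ B) x → (a ⊙ˢ B) (x + x)
    double (y , by , refl) = y + y , double-closed by , solve 2 (λ a y → a :* y :+ a :* y := a :* (y :+ y)) refl a y
    down : ∀ {x y} → (a ⊙ˢ B) y → ∣ x ∣ ≤ ∣ y ∣ → (a ⊙ˢ B) x
    down {x} (w , bw , refl) p with em {a ≡ 0#}
    ... | yes refl = 0# , 0∈ , trans (∣x∣≤0⇒x≡0 (≤-resp refl (trans (cong ∣_∣ (zeroˡ w)) (∣x∣≡x ≤-refl)) p)) (sym (zeroʳ 0#))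
    ... | no a≢0 = a ⁻¹ * x , ∣∣-down bw (divide-≤ a≢0 p) , sym (cancelˡ x a≢0)

  ⊗-CSG : ∀ {A B} → IsCSG A → IsCSG B → IsCSG (A ⊗ˢ B)
  ⊗-CSG {A} {B} ca cb = convexSubgroup-intro (0# , 0# , CSG.0∈ ca , CSG.0∈ cb , sym (zeroʳ 0#)) double down
    where
    double : ∀ {x} → (A ⊗ˢ B) x → (A ⊗ˢ B) (x + x)
    double (u , v , au , bv , refl) = u , v + v , au , CSG.double-closed cb bv , solve 2 (λ u v → u :* v :+ u :* v := u :* (v :+ v)) refl u v
    -- below ∣ u v ∣ everything has the form u v′ with v′ ∈ B
    down : ∀ {x y} → (A ⊗ˢ B) y → ∣ x ∣ ≤ ∣ y ∣ → (A ⊗ˢ B) x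
    down (u , v , au , bv , refl) p =
      let (v′ , bv′ , e) = CSG.∣∣-down (⊙-CSG u cb) (v , bv , refl) p in u , v′ , au , bv′ , e

  ⊘-CSG : ∀ {S} c → IsCSG S → IsCSG (S ⊘ˢ c)
  ⊘-CSG c cs = IsCSG-resp (λ { (x , sx , e) → x , sx , trans e (*-comm (c ⁻¹) x) })
                          (λ { (x , sx , e) → x , sx , trans e (*-comm x (c ⁻¹)) })
                          (⊙-CSG (c ⁻¹) cs)

  zeroCSG : Subset F
  zeroCSG x = x ≡ 0#

  zeroCSG-isCSG : IsCSG zeroCSG
  zeroCSG-isCSG = record
    { 0∈ = refl
    ; +-closed = λ { refl refl → +-identityˡ 0# }
    ; neg-closed = λ { refl → neg-0# }
    ; convex = λ { refl refl p q → antisym q p } }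

module Cosets {ℓ} (F : OrderedField ℓ) (em : ExcludedMiddle ℓ) where
  open OrderedField F
  open OrderedFieldFacts F
  open ConvexSubgroups F em

  infix 4 _≈_
  infixl 6 _⊞_
  infixl 7 _⊡_
  _≈_ : Rep F → Rep F → Set ℓ
  _≈_ = _≈Q_ F
  _⊞_ _⊡_ : Rep F → Rep F → Rep F
  _⊞_ = _+Q_ F
  _⊡_ = _·Q_ F

  ≈-isEquivalence : IsEquivalence _≈_
  ≈-isEquivalence = record
    { refl = λ x → (λ p → p) , (λ p → p)
    ; sym = λ h x → proj₂ (h x) , proj₁ (h x)
    ; trans = λ h g x → (λ p → proj₁ (g x) (proj₁ (h x) p)) , (λ p → proj₂ (h x) (proj₂ (g x) p)) }

  ≈-intro : ∀ {a A b B} → IsCSG A → A ≐ B → A (a - b) → (a , A) ≈ (b , B)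
  ≈-intro {a} {A} {b} {B} ca (A⊆B , B⊆A) a-b∈A x = to , from
    where
    to : _∈C_ F x (a , A) → _∈C_ F x (b , B)
    to (y , ay , refl) = (a - b) + y , A⊆B (CSG.+-closed ca a-b∈A ay) ,
      solve 3 (λ a b y → a :+ y := b :+ ((a :- b) :+ y)) refl a b y
    from : _∈C_ F x (b , B) → _∈C_ F x (a , A)
    from (y , by , refl) = y - (a - b) , CSG.sub-closed ca (B⊆A by) a-b∈A ,
      solve 3 (λ a b y → b :+ y := a :+ (y :- (a :- b))) refl a b y

  ≈-elim : ∀ {a A b B} → IsCSG A → IsCSG B → (a , A) ≈ (b , B) → A ≐ B × A (a - b)
  ≈-elim {a} {A} {b} {B} ca cb h = (A⊆B , B⊆A) , a-b∈A
    where
    -- a + y ∈ b + B exhibits y as a difference of elements of B, and symmetrically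
    shift : ∀ {T s t y} → IsCSG T → _∈C_ F (s + y) (t , T) → _∈C_ F s (t , T) → T y
    shift {s = s} {t} {y} ct (z , tz , e₁) (w , tw , e₂) = CSG.∈-resp ct (CSG.sub-closed ct tz tw) (begin
      z - w                ≡⟨ solve 3 (λ t z w → z :- w := (t :+ z) :- (t :+ w)) refl t z w ⟩
      (t + z) - (t + w)    ≡⟨ cong₂ _-_ (sym e₁) (sym e₂) ⟩
      (s + y) - s          ≡⟨ solve 2 (λ s y → (s :+ y) :- s := y) refl s y ⟩
      y                    ∎)
      where open ≡-Reasoning
    a∈a+A : _∈C_ F a (a , A)
    a∈a+A = 0# , CSG.0∈ ca , sym (+-identityʳ a)
    b∈b+B : _∈C_ F b (b , B)
    b∈b+B = 0# , CSG.0∈ cb , sym (+-identityʳ b)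
    A⊆B : A ⊆ B
    A⊆B {y} ay = shift cb (proj₁ (h (a + y)) (y , ay , refl)) (proj₁ (h a) a∈a+A)
    B⊆A : B ⊆ A
    B⊆A {y} by = shift ca (proj₂ (h (b + y)) (y , by , refl)) (proj₂ (h b) b∈b+B)
    a-b∈A : A (a - b)
    a-b∈A with proj₂ (h b) b∈b+B
    ... | w , aw , b≡a+w = CSG.∈-resp ca (CSG.neg-closed ca aw) (begin
      - w           ≡⟨ solve 2 (λ a w → :- w := a :- (a :+ w)) refl a w ⟩
      a - (a + w)   ≡⟨ cong (λ t → a - t) (sym b≡a+w) ⟩
      a - b         ∎)
      where open ≡-Reasoning

module AdditiveAssembly {ℓ} (F : OrderedField ℓ) (em : ExcludedMiddle ℓ) where
  open OrderedField F
  open OrderedFieldFacts F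
  open ConvexSubgroups F em
  open Cosets F em

  diff-zero : ∀ {A} → IsCSG A → ∀ {a b} → a ≡ b → A (a - b)
  diff-zero ca {a} refl = CSG.0≡-closed ca (solve 1 (λ a → :0 := a :- a) refl a)

  ⊞-cong : ∀ {x x′ y y′} → InQ F x → InQ F x′ → InQ F y → InQ F y′ → x ≈ x′ → y ≈ y′ → x ⊞ y ≈ x′ ⊞ y′
  ⊞-cong {a , A} {a′ , A′} {b , B} {b′ , B′} ca ca′ cb cb′ x≈x′ y≈y′ =
    let ((A⊆ , A⊇) , a-a′) = ≈-elim ca ca′ x≈x′ ; ((B⊆ , B⊇) , b-b′) = ≈-elim cb cb′ y≈y′ in
    ≈-intro (⊕-CSG ca cb) (⊕-mono A⊆ B⊆ , ⊕-mono A⊇ B⊇)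
      (CSG.∈-resp (⊕-CSG ca cb) (⊕-intro a-a′ b-b′)
        (solve 4 (λ a a′ b b′ → (a :- a′) :+ (b :- b′) := (a :+ b) :- (a′ :+ b′)) refl a a′ b b′))

  ⊞-assoc : ∀ {x y z} → InQ F x → InQ F y → InQ F z → (x ⊞ y) ⊞ z ≈ x ⊞ (y ⊞ z)
  ⊞-assoc {a , A} {b , B} {c , C} ca cb cc = ≈-intro cL (⊕-assoc ca cb cc)
    (diff-zero cL (solve 3 (λ a b c → a :+ b :+ c := a :+ (b :+ c)) refl a b c))
    where cL = ⊕-CSG (⊕-CSG ca cb) cc

  ⊞-comm : ∀ {x y} → InQ F x → InQ F y → x ⊞ y ≈ y ⊞ x
  ⊞-comm {a , A} {b , B} ca cb = ≈-intro (⊕-CSG ca cb) (⊕-comm ca cb) (diff-zero (⊕-CSG ca cb) (+-comm a b))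

  e-cong : ∀ {x y} → InQ F x → InQ F y → x ≈ y → eQ F x ≈ eQ F y
  e-cong {a , A} {b , B} ca cb x≈y = ≈-intro ca (proj₁ (≈-elim ca cb x≈y)) (diff-zero ca refl)

  e-neutral : ∀ {x} → InQ F x → x ⊞ eQ F x ≈ x
  e-neutral {a , A} ca = ≈-intro (⊕-CSG ca ca) (⊕-idem ca) (diff-zero (⊕-CSG ca ca) (+-identityʳ a))

  -- x + f = x forces B ⊆ A and b ∈ A, hence A + B = A
  e-least : ∀ {x f} → InQ F x → InQ F f → x ⊞ f ≈ x → eQ F x ⊞ f ≈ eQ F x
  e-least {a , A} {b , B} ca cb x+f≈x =
    let (A⊕B≐A , [a+b]-a) = ≈-elim (⊕-CSG ca cb) ca x+f≈x in
    ≈-intro (⊕-CSG ca cb) A⊕B≐A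
      (CSG.∈-resp (⊕-CSG ca cb) [a+b]-a (solve 2 (λ a b → (a :+ b) :- a := (:0 :+ b) :- :0) refl a b))

  s-cong : ∀ {x y} → InQ F x → InQ F y → x ≈ y → sQ F x ≈ sQ F y
  s-cong {a , A} {b , B} ca cb x≈y =
    let (A≐B , a-b) = ≈-elim ca cb x≈y in
    ≈-intro ca A≐B (CSG.∈-resp ca (CSG.neg-closed ca a-b) (solve 2 (λ a b → :- (a :- b) := :- a :- :- b) refl a b))

  s-inverse : ∀ {x} → InQ F x → x ⊞ sQ F x ≈ eQ F x
  s-inverse {a , A} ca = ≈-intro (⊕-CSG ca ca) (⊕-idem ca) (diff-zero (⊕-CSG ca ca) (solve 1 (λ a → a :+ :- a := :0) refl a))

  e-+ : ∀ {x y} → InQ F x → InQ F y → (eQ F (x ⊞ y) ≈ eQ F x) ⊎ (eQ F (x ⊞ y) ≈ eQ F y)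
  e-+ {a , A} {b , B} ca cb with ⊕-max ca cb
  ... | inj₁ A⊕B≐A = inj₁ (≈-intro (⊕-CSG ca cb) A⊕B≐A (diff-zero (⊕-CSG ca cb) refl))
  ... | inj₂ A⊕B≐B = inj₂ (≈-intro (⊕-CSG ca cb) A⊕B≐B (diff-zero (⊕-CSG ca cb) refl))

  +-assembly : IsAssemblyOn _≈_ (InQ F) _⊞_ (eQ F) (sQ F)
  +-assembly = record
    { isEquivalence = ≈-isEquivalence
    ; nonempty = (0# , zeroCSG) , zeroCSG-isCSG
    ; ∗-closed = ⊕-CSG
    ; ∗-cong = ⊞-cong
    ; assoc = ⊞-assoc
    ; comm = ⊞-comm
    ; e-closed = λ {x} cx → cx
    ; e-cong = e-cong
    ; e-neutral = e-neutral
    ; e-least = e-least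
    ; s-closed = λ {x} cx → cx
    ; s-cong = s-cong
    ; s-inverse = s-inverse
    ; e-s = λ { {a , A} ca → ≈-intro ca ≐-refl (diff-zero ca refl) }
    ; e-∗ = λ {x} {y} → e-+ {x} {y}
    }

module ProductSets {ℓ} (F : OrderedField ℓ) (em : ExcludedMiddle ℓ) where
  open OrderedField F
  open OrderedFieldFacts F
  open ConvexSubgroups F em

  P : Carrier → Subset F → Carrier → Subset F → Subset F
  P a A b B = a ⊙ˢ B ⊕ˢ b ⊙ˢ A ⊕ˢ A ⊗ˢ B

  P-CSG : ∀ {A B} a b → IsCSG A → IsCSG B → IsCSG (P a A b B)
  P-CSG a b ca cb = ⊕-CSG (⊕-CSG (⊙-CSG a cb) (⊙-CSG b ca)) (⊗-CSG ca cb)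

  P-intro : ∀ {a A b B β α α′ β′} → B β → A α → A α′ → B β′ → P a A b B (a * β + b * α + α′ * β′)
  P-intro {β = β} {α} {α′} {β′} bβ aα aα′ bβ′ = ⊕-intro (⊕-intro (β , bβ , refl) (α , aα , refl)) (α′ , β′ , aα′ , bβ′ , refl)

  P-cases : ∀ {a A b B z} {G : Set ℓ} → P a A b B z →
            (∀ {β α α′ β′} → B β → A α → A α′ → B β′ → z ≡ a * β + b * α + α′ * β′ → G) → G
  P-cases (_ , _ , (_ , _ , (β , bβ , refl) , (α , aα , refl) , refl) , (α′ , β′ , aα′ , bβ′ , refl) , z≡) k =
    k bβ aα aα′ bβ′ z≡

  P-lub : ∀ {a A b B T} → IsCSG T → (∀ {β} → B β → T (a * β)) → (∀ {α} → A α → T (b * α)) →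
          (∀ {α β} → A α → B β → T (α * β)) → P a A b B ⊆ T
  P-lub ct aB⊆T bA⊆T AB⊆T = ⊕-lub ct (⊕-lub ct (λ { (β , bβ , refl) → aB⊆T bβ }) (λ { (α , aα , refl) → bA⊆T aα }))
                                     (λ { (α , β , aα , bβ , refl) → AB⊆T aα bβ })

  aB⊆P : ∀ {a A b B β} → IsCSG A → IsCSG B → B β → P a A b B (a * β)
  aB⊆P {a} {b = b} {β = β} ca cb bβ = CSG.∈-resp (P-CSG a b ca cb) (P-intro bβ (CSG.0∈ ca) (CSG.0∈ ca) (CSG.0∈ cb))
     (solve 3 (λ a b β → a :* β :+ b :* :0 :+ :0 :* :0 := a :* β) refl a b β)

  bA⊆P : ∀ {a A b B α} → IsCSG A → IsCSG B → A α → P a A b B (b * α)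
  bA⊆P {a} {b = b} {α = α} ca cb aα = CSG.∈-resp (P-CSG a b ca cb) (P-intro (CSG.0∈ cb) aα (CSG.0∈ ca) (CSG.0∈ cb))
     (solve 3 (λ a b α → a :* :0 :+ b :* α :+ :0 :* :0 := b :* α) refl a b α)

  AB⊆P : ∀ {a A b B α β} → IsCSG A → IsCSG B → A α → B β → P a A b B (α * β)
  AB⊆P {a} {b = b} {α = α} {β} ca cb aα bβ = CSG.∈-resp (P-CSG a b ca cb) (P-intro (CSG.0∈ cb) (CSG.0∈ ca) aα bβ)
     (solve 4 (λ a b α β → a :* :0 :+ b :* :0 :+ α :* β := α :* β) refl a b α β)

  P-mono : ∀ {a A b B a′ A′ b′ B′} → IsCSG A′ → IsCSG B′ → A ⊆ A′ → B ⊆ B′ →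
           A′ (a - a′) → B′ (b - b′) → P a A b B ⊆ P a′ A′ b′ B′
  P-mono {a} {A} {b} {B} {a′} {A′} {b′} {B′} ca′ cb′ A⊆ B⊆ a-a′ b-b′ = P-lub cP aβ bα (λ aα bβ → AB⊆P ca′ cb′ (A⊆ aα) (B⊆ bβ))
    where
    cP = P-CSG a′ b′ ca′ cb′
    aβ : ∀ {β} → B β → P a′ A′ b′ B′ (a * β)
    aβ {β} bβ = CSG.sum₂-closed cP (aB⊆P ca′ cb′ (B⊆ bβ)) (AB⊆P ca′ cb′ a-a′ (B⊆ bβ))
      (solve 3 (λ a a′ β → a′ :* β :+ (a :- a′) :* β := a :* β) refl a a′ β)
    bα : ∀ {α} → A α → P a′ A′ b′ B′ (b * α)
    bα {α} aα = CSG.sum₂-closed cP (bA⊆P ca′ cb′ (A⊆ aα)) (AB⊆P ca′ cb′ (A⊆ aα) b-b′)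
      (solve 3 (λ b b′ α → b′ :* α :+ α :* (b :- b′) := b :* α) refl b b′ α)

module ProductLaws {ℓ} (F : OrderedField ℓ) (em : ExcludedMiddle ℓ) where
  open OrderedField F
  open OrderedFieldFacts F
  open ConvexSubgroups F em
  open Cosets F em
  open ProductSets F em

  ·-closed : ∀ {x y} → InQ F x → InQ F y → InQ F (x ⊡ y)
  ·-closed {a , A} {b , B} ca cb = P-CSG a b ca cb

  ·-cong : ∀ {x x′ y y′} → InQ F x → InQ F x′ → InQ F y → InQ F y′ → x ≈ x′ → y ≈ y′ → x ⊡ y ≈ x′ ⊡ y′
  ·-cong {a , A} {a′ , A′} {b , B} {b′ , B′} ca ca′ cb cb′ a≈a′ b≈b′ =
    ≈-intro cP (P-mono ca′ cb′ A⊆ B⊆ (A⊆ a-a′) (B⊆ b-b′) , P-mono ca cb A⊇ B⊇ (CSG.swap-closed ca a-a′) (CSG.swap-closed cb b-b′))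
      (CSG.sum₃-closed cP (aB⊆P ca cb b-b′) (bA⊆P ca cb a-a′) (AB⊆P ca cb (CSG.neg-closed ca a-a′) b-b′)
         (solve 4 (λ a a′ b b′ → a :* (b :- b′) :+ b :* (a :- a′) :+ :- (a :- a′) :* (b :- b′) := a :* b :- a′ :* b′) refl a a′ b b′))
    where
    cP = P-CSG a b ca cb
    A≐ = ≈-elim ca ca′ a≈a′
    B≐ = ≈-elim cb cb′ b≈b′
    A⊆ = proj₁ (proj₁ A≐)
    A⊇ = proj₂ (proj₁ A≐)
    a-a′ = proj₂ A≐
    B⊆ = proj₁ (proj₁ B≐)
    B⊇ = proj₂ (proj₁ B≐)
    b-b′ = proj₂ B≐

  P-swap : ∀ {a A b B} → IsCSG A → IsCSG B → P a A b B ⊆ P b B a A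
  P-swap {a} {A} {b} {B} ca cb = P-lub (P-CSG b a cb ca) (bA⊆P cb ca) (aB⊆P cb ca)
    (λ {α} {β} aα bβ → CSG.∈-resp (P-CSG b a cb ca) (AB⊆P cb ca bβ aα) (*-comm β α))

  ·-comm : ∀ {x y} → InQ F x → InQ F y → x ⊡ y ≈ y ⊡ x
  ·-comm {a , A} {b , B} ca cb = ≈-intro (P-CSG a b ca cb) (P-swap ca cb , P-swap cb ca)
    (CSG.0≡-closed (P-CSG a b ca cb) (solve 2 (λ a b → :0 := a :* b :- b :* a) refl a b))

  ·-assoc : ∀ {x y z} → InQ F x → InQ F y → InQ F z → (x ⊡ y) ⊡ z ≈ x ⊡ (y ⊡ z)
  ·-assoc {a , A} {b , B} {c , C} ca cb cc = ≈-intro cL (L⊆R , R⊆L)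
      (CSG.0≡-closed cL (solve 3 (λ a b c → :0 := a :* b :* c :- a :* (b :* c)) refl a b c))
    where
    cab = P-CSG a b ca cb
    cbc = P-CSG b c cb cc
    cL = P-CSG (a * b) c cab cc
    cR = P-CSG a (b * c) ca cbc
    L⊆R : P (a * b) (P a A b B) c C ⊆ P a A (b * c) (P b B c C)
    L⊆R = P-lub cR abγ cp pγ
      where
      abγ : ∀ {γ} → C γ → P a A (b * c) (P b B c C) (a * b * γ)
      abγ {γ} cγ = CSG.∈-resp cR (aB⊆P ca cbc (aB⊆P cb cc cγ)) (solve 3 (λ a b γ → a :* (b :* γ) := a :* b :* γ) refl a b γ)
      cp : ∀ {p} → P a A b B p → P a A (b * c) (P b B c C) (c * p)
      cp pp = P-cases pp λ {β} {α} {α′} {β′} bβ aα aα′ bβ′ p≡ →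
        CSG.sum₃-closed cR (aB⊆P ca cbc (bA⊆P cb cc bβ)) (bA⊆P ca cbc aα) (AB⊆P ca cbc aα′ (bA⊆P cb cc bβ′))
          (trans (solve 7 (λ a b c β α α′ β′ → a :* (c :* β) :+ b :* c :* α :+ α′ :* (c :* β′) := c :* (a :* β :+ b :* α :+ α′ :* β′)) refl a b c β α α′ β′)
                 (cong (c *_) (sym p≡)))
      pγ : ∀ {p γ} → P a A b B p → C γ → P a A (b * c) (P b B c C) (p * γ)
      pγ {γ = γ} pp cγ = P-cases pp λ {β} {α} {α′} {β′} bβ aα aα′ bβ′ p≡ →
        CSG.sum₃-closed cR (aB⊆P ca cbc (AB⊆P cb cc bβ cγ)) (AB⊆P ca cbc aα (aB⊆P cb cc cγ)) (AB⊆P ca cbc aα′ (AB⊆P cb cc bβ′ cγ))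
          (trans (solve 7 (λ a b γ β α α′ β′ → a :* (β :* γ) :+ α :* (b :* γ) :+ α′ :* (β′ :* γ) := (a :* β :+ b :* α :+ α′ :* β′) :* γ) refl a b γ β α α′ β′)
                 (cong (_* γ) (sym p≡)))
    R⊆L : P a A (b * c) (P b B c C) ⊆ P (a * b) (P a A b B) c C
    R⊆L = P-lub cL aq bcα αq
      where
      aq : ∀ {q} → P b B c C q → P (a * b) (P a A b B) c C (a * q)
      aq qq = P-cases qq λ {γ} {β} {β′} {γ′} cγ bβ bβ′ cγ′ q≡ →
        CSG.sum₃-closed cL (aB⊆P cab cc cγ) (bA⊆P cab cc (aB⊆P ca cb bβ)) (AB⊆P cab cc (aB⊆P ca cb bβ′) cγ′)
          (trans (solve 7 (λ a b c γ β β′ γ′ → a :* b :* γ :+ c :* (a :* β) :+ a :* β′ :* γ′ := a :* (b :* γ :+ c :* β :+ β′ :* γ′)) refl a b c γ β β′ γ′)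
                 (cong (a *_) (sym q≡)))
      bcα : ∀ {α} → A α → P (a * b) (P a A b B) c C (b * c * α)
      bcα {α} aα = CSG.∈-resp cL (bA⊆P cab cc (bA⊆P ca cb aα)) (solve 3 (λ b c α → c :* (b :* α) := b :* c :* α) refl b c α)
      αq : ∀ {α q} → A α → P b B c C q → P (a * b) (P a A b B) c C (α * q)
      αq {α} aα qq = P-cases qq λ {γ} {β} {β′} {γ′} cγ bβ bβ′ cγ′ q≡ →
        CSG.sum₃-closed cL (AB⊆P cab cc (bA⊆P ca cb aα) cγ) (bA⊆P cab cc (AB⊆P ca cb aα bβ)) (AB⊆P cab cc (AB⊆P ca cb aα bβ′) cγ′)
          (trans (solve 7 (λ α b c γ β β′ γ′ → b :* α :* γ :+ c :* (α :* β) :+ α :* β′ :* γ′ := α :* (b :* γ :+ c :* β :+ β′ :* γ′)) refl α b c γ β β′ γ′)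
                 (cong (α *_) (sym q≡)))

  distrib : ∀ {x y z} → InQ F x → InQ F y → InQ F z →
            x ⊡ y ⊞ x ⊡ z ≈ x ⊡ (y ⊞ z) ⊞ eQ F x ⊡ y ⊞ eQ F x ⊡ z
  distrib {a , A} {b , B} {c , C} ca cb cc = ≈-intro cL (L⊆R , R⊆L)
      (CSG.0≡-closed cL (solve 3 (λ a b c → :0 := a :* b :+ a :* c :- (a :* (b :+ c) :+ :0 :* b :+ :0 :* c)) refl a b c))
    where
    cbc = ⊕-CSG cb cc
    c₁ = P-CSG a (b + c) ca cbc
    c₂ = P-CSG 0# b ca cb
    c₃ = P-CSG 0# c ca cc
    cab = P-CSG a b ca cb
    cac = P-CSG a c ca cc
    cL = ⊕-CSG cab cac
    cR = ⊕-CSG (⊕-CSG c₁ c₂) c₃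
    Lset = P a A b B ⊕ˢ P a A c C
    Rset = P a A (b + c) (B ⊕ˢ C) ⊕ˢ P 0# A b B ⊕ˢ P 0# A c C
    in₁ : P a A (b + c) (B ⊕ˢ C) ⊆ Rset
    in₁ x = ⊕-inl c₃ (⊕-inl c₂ x)
    in₂ : P 0# A b B ⊆ Rset
    in₂ x = ⊕-inl c₃ (⊕-inr c₁ x)
    in₃ : P 0# A c C ⊆ Rset
    in₃ x = ⊕-inr (⊕-CSG c₁ c₂) x
    inˡ : P a A b B ⊆ Lset
    inˡ = ⊕-inl cac
    inʳ : P a A c C ⊆ Lset
    inʳ = ⊕-inr cab
    L⊆R : Lset ⊆ Rset
    L⊆R = ⊕-lub cR
      (P-lub cR (λ bβ → in₁ (aB⊆P ca cbc (⊕-inl cc bβ))) (λ aα → in₂ (bA⊆P ca cb aα)) (λ aα bβ → in₂ (AB⊆P ca cb aα bβ)))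
      (P-lub cR (λ cγ → in₁ (aB⊆P ca cbc (⊕-inr cb cγ))) (λ aα → in₃ (bA⊆P ca cc aα)) (λ aα cγ → in₃ (AB⊆P ca cc aα cγ)))
    R⊆L : Rset ⊆ Lset
    R⊆L = ⊕-lub cL (⊕-lub cL
       (P-lub cL (λ { (β , γ , bβ , cγ , refl) → CSG.sum₂-closed cL (inˡ (aB⊆P ca cb bβ)) (inʳ (aB⊆P ca cc cγ))
                       (solve 3 (λ a β γ → a :* β :+ a :* γ := a :* (β :+ γ)) refl a _ _) })
                 (λ aα → CSG.sum₂-closed cL (inˡ (bA⊆P ca cb aα)) (inʳ (bA⊆P ca cc aα))
                       (solve 3 (λ b c α → b :* α :+ c :* α := (b :+ c) :* α) refl b c _))
                 (λ { aα (β , γ , bβ , cγ , refl) → CSG.sum₂-closed cL (inˡ (AB⊆P ca cb aα bβ)) (inʳ (AB⊆P ca cc aα cγ))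
                       (solve 3 (λ α β γ → α :* β :+ α :* γ := α :* (β :+ γ)) refl _ _ _) }))
       (P-lub cL (λ _ → CSG.0*-closed cL) (λ aα → inˡ (bA⊆P ca cb aα)) (λ aα bβ → inˡ (AB⊆P ca cb aα bβ))))
       (P-lub cL (λ _ → CSG.0*-closed cL) (λ aα → inʳ (bA⊆P ca cc aα)) (λ aα cγ → inʳ (AB⊆P ca cc aα cγ)))

  e·-is-e : ∀ {x y} → InQ F x → InQ F y → Σ (Rep F) λ w → InQ F w × (eQ F x ⊡ y ≈ eQ F w)
  e·-is-e {a , A} {b , B} ca cb = (0# * b , P 0# A b B) , cP ,
    ≈-intro cP ≐-refl (CSG.0≡-closed cP (solve 1 (λ b → :0 := :0 :* b :- :0) refl b))
    where cP = P-CSG 0# b ca cb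

  e-· : ∀ {x y} → InQ F x → InQ F y → eQ F (x ⊡ y) ≈ eQ F x ⊡ y ⊞ eQ F y ⊡ x
  e-· {a , A} {b , B} ca cb = ≈-intro cL (L⊆R , R⊆L) (CSG.0≡-closed cL (solve 2 (λ a b → :0 := :0 :- (:0 :* b :+ :0 :* a)) refl a b))
    where
    cL = P-CSG a b ca cb
    c₁ = P-CSG 0# b ca cb
    c₂ = P-CSG 0# a cb ca
    cR = ⊕-CSG c₁ c₂
    L⊆R : P a A b B ⊆ P 0# A b B ⊕ˢ P 0# B a A
    L⊆R = P-lub cR (λ bβ → ⊕-inr c₁ (bA⊆P cb ca bβ)) (λ aα → ⊕-inl c₂ (bA⊆P ca cb aα)) (λ aα bβ → ⊕-inl c₂ (AB⊆P ca cb aα bβ))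
    R⊆L : P 0# A b B ⊕ˢ P 0# B a A ⊆ P a A b B
    R⊆L = ⊕-lub cL (P-lub cL (λ _ → CSG.0*-closed cL) (bA⊆P ca cb) (AB⊆P ca cb))
                   (P-lub cL (λ _ → CSG.0*-closed cL) (aB⊆P ca cb) (λ bβ aα → P-swap cb ca (AB⊆P cb ca bβ aα)))

  -- aB = (-a)B, since B is symmetric
  P-negate : ∀ {a A b B} → IsCSG A → IsCSG B → P a A b B ⊆ P (- a) A b B
  P-negate {a} {A} {b} {B} ca cb = P-lub cP
    (λ {β} bβ → CSG.∈-resp cP (aB⊆P ca cb (CSG.neg-closed cb bβ)) (solve 2 (λ a β → :- a :* :- β := a :* β) refl a β))
    (bA⊆P ca cb) (AB⊆P ca cb)
    where cP = P-CSG (- a) b ca cb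

  s-· : ∀ {x y} → InQ F x → InQ F y → sQ F (x ⊡ y) ≈ sQ F x ⊡ y
  s-· {a , A} {b , B} ca cb = ≈-intro cL (P-negate ca cb , P⁻⊆P)
      (CSG.0≡-closed cL (solve 2 (λ a b → :0 := :- (a :* b) :- :- a :* b) refl a b))
    where
    cL = P-CSG a b ca cb
    P⁻⊆P : P (- a) A b B ⊆ P a A b B
    P⁻⊆P p = subst (λ t → P t A b B _) (neg-involutive a) (P-negate ca cb p)

module Quotients {ℓ} (F : OrderedField ℓ) (em : ExcludedMiddle ℓ) where
  open OrderedField F
  open OrderedFieldFacts F
  open ConvexSubgroups F em
  open ≡-Reasoning

  ⊘-mono : ∀ {S T c} → S ⊆ T → S ⊘ˢ c ⊆ T ⊘ˢ c
  ⊘-mono S⊆T (x , sx , e) = x , S⊆T sx , e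

  -- if b ∉ B and β ∈ B then ∣ β / b ∣ ≤ 1, so α (β / b) ∈ A for every α ∈ A
  scaled-closed : ∀ {A B b β α} → IsCSG A → IsCSG B → ¬ B b → B β → A α → A (α * (β * b ⁻¹))
  scaled-closed ca cb b∉B bβ aα =
    CSG.∣∣-down ca aα (contract-≤ (ratio-≤1 (CSG.outside-nonzero cb b∉B) (CSG.outside-dominates cb b∉B bβ)))

  comparable : ∀ {S a a′} → IsCSG S → ¬ S a → S (a - a′) → ∣ a′ ∣ ≤ ∣ a ∣ + ∣ a ∣
  comparable {S} {a} {a′} cs a∉S a-a′ =
    ≤-resp (cong ∣_∣ (solve 2 (λ a a′ → a :+ :- (a :- a′) := a′) refl a a′)) refl
      (≤-trans (triangle a (- (a - a′)))
        (+-monoʳ-≤ ∣ a ∣ (≤-resp (sym (∣-x∣≡∣x∣ (a - a′))) refl (CSG.outside-dominates cs a∉S a-a′))))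

  doubled-closed : ∀ {S x r} → IsCSG S → S x → ∣ r ∣ ≤ 1# + 1# → S (x * r)
  doubled-closed {S} {x} {r} cs sx p = CSG.∣∣-down cs (CSG.double-closed cs (CSG.∣∣-closed cs sx)) (≤-resp refl (begin
    ∣ x ∣ * (1# + 1#)    ≡⟨ solve 1 (λ u → u :* (:1 :+ :1) := u :+ u) refl ∣ x ∣ ⟩
    ∣ x ∣ + ∣ x ∣        ≡⟨ sym (∣x∣≡x (0≤x+x (0≤∣x∣ x))) ⟩
    ∣ ∣ x ∣ + ∣ x ∣ ∣    ∎) (≤-resp (sym (∣x*y∣≡∣x∣*∣y∣ x r)) refl (*-monoˡ-≤ (0≤∣x∣ x) p)))

  -- S / c ⊆ S / c′ as soon as ∣ c′ ∣ ≤ 2 ∣ c ∣, because x / c = (x (c′ / c)) / c′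
  ⊘-divisor : ∀ {S c c′} → IsCSG S → c ≢ 0# → c′ ≢ 0# → ∣ c′ ∣ ≤ ∣ c ∣ + ∣ c ∣ → S ⊘ˢ c ⊆ S ⊘ˢ c′
  ⊘-divisor {S} {c} {c′} cs c≢0 c′≢0 p (x , sx , refl) = x * (c′ * c ⁻¹) , doubled-closed cs sx (ratio-≤2 c≢0 p) , (begin
    x * c ⁻¹                      ≡⟨ sym (*-identityʳ _) ⟩
    x * c ⁻¹ * 1#                 ≡⟨ cong (x * c ⁻¹ *_) (sym (⁻¹-inverse c′ c′≢0)) ⟩
    x * c ⁻¹ * (c′ * c′ ⁻¹)       ≡⟨ solve 4 (λ x i c′ j → x :* i :* (c′ :* j) := x :* (c′ :* i) :* j) refl x (c ⁻¹) c′ (c′ ⁻¹) ⟩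
    x * (c′ * c ⁻¹) * c′ ⁻¹       ∎)

  scale-≤2 : ∀ c {d e} → ∣ d ∣ ≤ ∣ e ∣ + ∣ e ∣ → ∣ c * d ∣ ≤ ∣ c * e ∣ + ∣ c * e ∣
  scale-≤2 c {d} {e} p = ≤-resp (sym (∣x*y∣≡∣x∣*∣y∣ c d))
    (trans (solve 2 (λ u v → u :* (v :+ v) := u :* v :+ u :* v) refl (∣ c ∣) (∣ e ∣))
           (sym (cong₂ _+_ (∣x*y∣≡∣x∣*∣y∣ c e) (∣x*y∣≡∣x∣*∣y∣ c e))))
    (*-monoˡ-≤ (0≤∣x∣ c) p)

  -- the same for squares: S / c² ⊆ S / (c c′) ⊆ S / c′²
  ⊘-divisor² : ∀ {S c c′} → IsCSG S → c ≢ 0# → c′ ≢ 0# → ∣ c′ ∣ ≤ ∣ c ∣ + ∣ c ∣ → S ⊘ˢ (c * c) ⊆ S ⊘ˢ (c′ * c′)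
  ⊘-divisor² {S} {c} {c′} cs c≢0 c′≢0 p t =
    ⊘-divisor cs (*-nonzero c≢0 c′≢0) (*-nonzero c′≢0 c′≢0) c′c′≤2cc′ (⊘-divisor cs (*-nonzero c≢0 c≢0) (*-nonzero c≢0 c′≢0) (scale-≤2 c p) t)
    where
    ∣c′c∣≡∣cc′∣ = cong ∣_∣ (*-comm c′ c)
    c′c′≤2cc′ : ∣ c′ * c′ ∣ ≤ ∣ c * c′ ∣ + ∣ c * c′ ∣
    c′c′≤2cc′ = ≤-resp refl (cong₂ _+_ ∣c′c∣≡∣cc′∣ ∣c′c∣≡∣cc′∣) (scale-≤2 c′ p)

  1∉S/a : ∀ {S a} → IsCSG S → ¬ S a → ¬ (S ⊘ˢ a) 1#
  1∉S/a {S} {a} cs a∉S (x , sx , 1≡x/a) = a∉S (CSG.∈-resp cs sx (begin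
    x                  ≡⟨ sym (*-identityʳ x) ⟩
    x * 1#             ≡⟨ cong (x *_) (sym (x⁻¹*x≡1 a≢0)) ⟩
    x * (a ⁻¹ * a)     ≡⟨ solve 3 (λ x i a → x :* (i :* a) := x :* i :* a) refl x (a ⁻¹) a ⟩
    x * a ⁻¹ * a       ≡⟨ cong (_* a) (sym 1≡x/a) ⟩
    1# * a             ≡⟨ *-identityˡ a ⟩
    a                  ∎))
    where a≢0 = CSG.outside-nonzero cs a∉S

-- The key fact is that (ab + P a A b B)/ab = 1 + (A/a + B/b) for a ∉ A,
-- b ∉ B, so that u(xy) is the larger of u(x) and u(y).
module MultiplicativeAssembly {ℓ} (F : OrderedField ℓ) (em : ExcludedMiddle ℓ) where
  open OrderedField F
  open OrderedFieldFacts F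
  open ConvexSubgroups F em
  open Cosets F em
  open ProductSets F em
  open ProductLaws F em
  open Quotients F em
  open ≡-Reasoning

  NonNeutral : Rep F → Set ℓ
  NonNeutral = NotN _≈_ (InQ F) (eQ F)

  non-neutral⇒∉ : ∀ {a A} → IsCSG A → ¬ (a , A) ≈ (0# , A) → ¬ A a
  non-neutral⇒∉ {a} ca a≉0 a∈A = a≉0 (≈-intro ca ≐-refl (CSG.∈-resp ca a∈A (solve 1 (λ a → a := a :- :0) refl a)))

  ∉⇒non-neutral : ∀ {a A} → IsCSG A → ¬ A a → ¬ (a , A) ≈ (0# , A)
  ∉⇒non-neutral {a} ca a∉A a≈0 = a∉A (CSG.∈-resp ca (proj₂ (≈-elim ca ca a≈0)) (solve 1 (λ a → a :- :0 := a) refl a))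

  1-1∈ : ∀ {S} → IsCSG S → S (1# - 1#)
  1-1∈ cs = CSG.0≡-closed cs (solve 0 (:0 := :1 :- :1) refl)

  outside : ∀ {a A} → NonNeutral (a , A) → ¬ A a
  outside (ca , a≉0) = non-neutral⇒∉ ca a≉0

  x/a²≡x/a/a : ∀ {a} x → a ≢ 0# → x * (a * a) ⁻¹ ≡ x * a ⁻¹ * a ⁻¹
  x/a²≡x/a/a {a} x a≢0 = trans (cong (x *_) (⁻¹-*-homo a≢0 a≢0)) (solve 2 (λ x i → x :* (i :* i) := x :* i :* i) refl x (a ⁻¹))

  P-over-a² : ∀ {c a A} → IsCSG A → ¬ A a → (∀ {x} → A x → (A ⊘ˢ a) (c * (x * (a * a) ⁻¹))) →
              P c A (a ⁻¹) (A ⊘ˢ (a * a)) ≐ A ⊘ˢ a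
  P-over-a² {c} {a} {A} ca a∉A cA/a²⊆A/a =
      P-lub cA/a (λ { (x , ax , refl) → cA/a²⊆A/a ax }) (λ {α} aα → α , aα , *-comm (a ⁻¹) α)
        (λ { {α} aα (x , ax , refl) → α * (x * a ⁻¹) , scaled-closed ca ca a∉A ax aα , (begin
          α * (x * (a * a) ⁻¹)   ≡⟨ cong (α *_) (x/a²≡x/a/a x a≢0) ⟩
          α * (x * a ⁻¹ * a ⁻¹)  ≡⟨ solve 3 (λ α x i → α :* (x :* i :* i) := α :* (x :* i) :* i) refl α x (a ⁻¹) ⟩
          α * (x * a ⁻¹) * a ⁻¹  ∎) })
    , λ { (x , ax , refl) → CSG.∈-resp cP (bA⊆P ca (⊘-CSG (a * a) ca) ax) (*-comm (a ⁻¹) x) }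
    where
    a≢0 = CSG.outside-nonzero ca a∉A
    cA/a = ⊘-CSG a ca
    cP = P-CSG c (a ⁻¹) ca (⊘-CSG (a * a) ca)

  P/ab≐A/a⊕B/b : ∀ {a A b B} → IsCSG A → IsCSG B → ¬ A a → ¬ B b →
                 P a A b B ⊘ˢ (a * b) ≐ A ⊘ˢ a ⊕ˢ B ⊘ˢ b
  P/ab≐A/a⊕B/b {a} {A} {b} {B} ca cb a∉A b∉B = P/ab⊆ , ⊆P/ab
    where
    a≢0 = CSG.outside-nonzero ca a∉A
    b≢0 = CSG.outside-nonzero cb b∉B
    -- p/(ab) = (α + α′β′/b)/a + β/b for p = aβ + bα + α′β′
    P/ab⊆ : P a A b B ⊘ˢ (a * b) ⊆ A ⊘ˢ a ⊕ˢ B ⊘ˢ b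
    P/ab⊆ (p , pp , refl) = P-cases pp λ {β} {α} {α′} {β′} bβ aα aα′ bβ′ p≡ →
      CSG.∈-resp (⊕-CSG (⊘-CSG a ca) (⊘-CSG b cb))
        (⊕-intro (α + α′ * (β′ * b ⁻¹) , CSG.+-closed ca aα (scaled-closed ca cb b∉B bβ′ aα′) , refl) (β , bβ , refl))
        (begin
          (α + α′ * (β′ * b ⁻¹)) * a ⁻¹ + β * b ⁻¹
            ≡⟨ solve 6 (λ α α′ β′ j i β → (α :+ α′ :* (β′ :* j)) :* i :+ β :* j := :1 :* (β :* j) :+ :1 :* (α :* i) :+ α′ :* β′ :* (i :* j)) refl α α′ β′ (b ⁻¹) (a ⁻¹) β ⟩
          1# * (β * b ⁻¹) + 1# * (α * a ⁻¹) + α′ * β′ * (a ⁻¹ * b ⁻¹)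
            ≡⟨ cong₂ (λ u v → u * (β * b ⁻¹) + v * (α * a ⁻¹) + α′ * β′ * (a ⁻¹ * b ⁻¹)) (sym (⁻¹-inverse a a≢0)) (sym (⁻¹-inverse b b≢0)) ⟩
          a * a ⁻¹ * (β * b ⁻¹) + b * b ⁻¹ * (α * a ⁻¹) + α′ * β′ * (a ⁻¹ * b ⁻¹)
            ≡⟨ solve 8 (λ a i β j b α α′ β′ → a :* i :* (β :* j) :+ b :* j :* (α :* i) :+ α′ :* β′ :* (i :* j) := (a :* β :+ b :* α :+ α′ :* β′) :* (i :* j)) refl a (a ⁻¹) β (b ⁻¹) b α α′ β′ ⟩
          (a * β + b * α + α′ * β′) * (a ⁻¹ * b ⁻¹)
            ≡⟨ cong₂ _*_ (sym p≡) (sym (⁻¹-*-homo a≢0 b≢0)) ⟩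
          p * (a * b) ⁻¹ ∎)
    -- x/a + y/b = (bx + ay)/(ab)
    ⊆P/ab : A ⊘ˢ a ⊕ˢ B ⊘ˢ b ⊆ P a A b B ⊘ˢ (a * b)
    ⊆P/ab (_ , _ , (x , ax , refl) , (y , by , refl) , refl) =
      b * x + a * y , CSG.∈-resp (P-CSG a b ca cb) (P-intro by ax (CSG.0∈ ca) (CSG.0∈ cb))
        (solve 4 (λ a b x y → a :* y :+ b :* x :+ :0 :* :0 := b :* x :+ a :* y) refl a b x y) ,
      (begin
         x * a ⁻¹ + y * b ⁻¹
           ≡⟨ solve 4 (λ x i y j → x :* i :+ y :* j := :1 :* (x :* i) :+ :1 :* (y :* j)) refl x (a ⁻¹) y (b ⁻¹) ⟩
         1# * (x * a ⁻¹) + 1# * (y * b ⁻¹)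
           ≡⟨ cong₂ (λ s t → s * (x * a ⁻¹) + t * (y * b ⁻¹)) (sym (⁻¹-inverse b b≢0)) (sym (⁻¹-inverse a a≢0)) ⟩
         b * b ⁻¹ * (x * a ⁻¹) + a * a ⁻¹ * (y * b ⁻¹)
           ≡⟨ solve 6 (λ a i b j x y → b :* j :* (x :* i) :+ a :* i :* (y :* j) := (b :* x :+ a :* y) :* (i :* j)) refl a (a ⁻¹) b (b ⁻¹) x y ⟩
         (b * x + a * y) * (a ⁻¹ * b ⁻¹)
           ≡⟨ cong ((b * x + a * y) *_) (sym (⁻¹-*-homo a≢0 b≢0)) ⟩
         (b * x + a * y) * (a * b) ⁻¹ ∎)

  u-⊡ : ∀ {a A b B} → IsCSG A → IsCSG B → ¬ A a → ¬ B b →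
        (P a A b B ⊘ˢ (a * b) ≐ A ⊘ˢ a) ⊎ (P a A b B ⊘ˢ (a * b) ≐ B ⊘ˢ b)
  u-⊡ ca cb a∉A b∉B with ⊕-max (⊘-CSG _ ca) (⊘-CSG _ cb) | P/ab≐A/a⊕B/b ca cb a∉A b∉B
  ... | inj₁ (p , q) | (r , s) = inj₁ ((λ t → p (r t)) , (λ t → s (q t)))
  ... | inj₂ (p , q) | (r , s) = inj₂ ((λ t → p (r t)) , (λ t → s (q t)))

  ab∉P : ∀ {a A b B} → IsCSG A → IsCSG B → ¬ A a → ¬ B b → ¬ P a A b B (a * b)
  ab∉P {a} {A} {b} {B} ca cb a∉A b∉B ab∈P = excluded (u-⊡ ca cb a∉A b∉B)
    where
    1∈P/ab : (P a A b B ⊘ˢ (a * b)) 1#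
    1∈P/ab = a * b , ab∈P , sym (⁻¹-inverse (a * b) (*-nonzero (CSG.outside-nonzero ca a∉A) (CSG.outside-nonzero cb b∉B)))
    excluded : (P a A b B ⊘ˢ (a * b) ≐ A ⊘ˢ a) ⊎ (P a A b B ⊘ˢ (a * b) ≐ B ⊘ˢ b) → ⊥
    excluded (inj₁ (P/ab⊆A/a , _)) = 1∉S/a ca a∉A (P/ab⊆A/a 1∈P/ab)
    excluded (inj₂ (P/ab⊆B/b , _)) = 1∉S/a cb b∉B (P/ab⊆B/b 1∈P/ab)

  ⊡-closed : ∀ {x y} → NonNeutral x → NonNeutral y → NonNeutral (x ⊡ y)
  ⊡-closed {a , A} {b , B} nx@(ca , _) ny@(cb , _) =
    P-CSG a b ca cb , ∉⇒non-neutral (P-CSG a b ca cb) (ab∉P ca cb (outside nx) (outside ny))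

  u-closed : ∀ {x} → NonNeutral x → NonNeutral (uQ F x)
  u-closed {a , A} nx@(ca , _) = ⊘-CSG a ca , ∉⇒non-neutral (⊘-CSG a ca) (1∉S/a ca (outside nx))

  -- a⁻¹ ∈ A/a² would give a ∈ A
  d-closed : ∀ {x} → NonNeutral x → NonNeutral (dQ F x)
  d-closed {a , A} nx@(ca , _) = ⊘-CSG (a * a) ca , ∉⇒non-neutral (⊘-CSG (a * a) ca) a⁻¹∉A/a²
    where
    a≢0 = CSG.outside-nonzero ca (outside nx)
    a⁻¹∉A/a² : ¬ (A ⊘ˢ (a * a)) (a ⁻¹)
    a⁻¹∉A/a² (x , ax , a⁻¹≡x/a²) = outside nx (CSG.∈-resp ca ax (begin
      x                        ≡⟨ sym (cancelʳ x (*-nonzero a≢0 a≢0)) ⟩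
      a * a * (x * (a * a) ⁻¹) ≡⟨ cong (a * a *_) (sym a⁻¹≡x/a²) ⟩
      a * a * a ⁻¹             ≡⟨ solve 2 (λ a i → a :* a :* i := a :* (a :* i)) refl a (a ⁻¹) ⟩
      a * (a * a ⁻¹)           ≡⟨ cong (a *_) (⁻¹-inverse a a≢0) ⟩
      a * 1#                   ≡⟨ *-identityʳ a ⟩
      a                        ∎))

  -- x u(x) = x: a(A/a) + A + A(A/a) = A
  u-neutral : ∀ {x} → NonNeutral x → x ⊡ uQ F x ≈ x
  u-neutral {a , A} nx@(ca , _) = ≈-intro cP (P⊆A , A⊆P) (CSG.0≡-closed cP (solve 1 (λ a → :0 := a :* :1 :- a) refl a))
    where
    a∉A = outside nx
    cP = P-CSG a 1# ca (⊘-CSG a ca)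
    P⊆A : P a A 1# (A ⊘ˢ a) ⊆ A
    P⊆A = P-lub ca (λ { (x , ax , refl) → CSG.∈-resp ca ax (sym (cancelʳ x (CSG.outside-nonzero ca a∉A))) })
                   (λ {α} aα → CSG.∈-resp ca aα (sym (*-identityˡ α)))
                   (λ { aα (x , ax , refl) → scaled-closed ca ca a∉A ax aα })
    A⊆P : A ⊆ P a A 1# (A ⊘ˢ a)
    A⊆P {α} aα = CSG.∈-resp cP (bA⊆P ca (⊘-CSG a ca) aα) (*-identityˡ α)

  d-inverse : ∀ {x} → NonNeutral x → x ⊡ dQ F x ≈ uQ F x
  d-inverse {a , A} nx@(ca , _) = ≈-intro (P-CSG a (a ⁻¹) ca (⊘-CSG (a * a) ca)) (P-over-a² ca a∉A a[A/a²]⊆A/a)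
      (CSG.0≡-closed (P-CSG a (a ⁻¹) ca (⊘-CSG (a * a) ca)) (trans (solve 0 (:0 := :1 :- :1) refl) (cong (_- 1#) (sym (⁻¹-inverse a a≢0)))))
    where
    a∉A = outside nx
    a≢0 = CSG.outside-nonzero ca a∉A
    a[A/a²]⊆A/a : ∀ {x} → A x → (A ⊘ˢ a) (a * (x * (a * a) ⁻¹))
    a[A/a²]⊆A/a {x} ax = x , ax , (begin
      a * (x * (a * a) ⁻¹)      ≡⟨ cong (a *_) (x/a²≡x/a/a x a≢0) ⟩
      a * (x * a ⁻¹ * a ⁻¹)     ≡⟨ cancelʳ (x * a ⁻¹) a≢0 ⟩
      x * a ⁻¹                  ∎)

  -- u(d(x)) = u(x): (A/a²)/a⁻¹ = A/a
  u-d : ∀ {x} → NonNeutral x → uQ F (dQ F x) ≈ uQ F x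
  u-d {a , A} nx@(ca , _) = ≈-intro (⊘-CSG (a ⁻¹) (⊘-CSG (a * a) ca))
      ((λ { (_ , (x , ax , refl) , refl) → x , ax , x/a²/a⁻¹≡x/a x })
      , (λ { (x , ax , refl) → x * (a * a) ⁻¹ , (x , ax , refl) , sym (x/a²/a⁻¹≡x/a x) }))
      (1-1∈ (⊘-CSG (a ⁻¹) (⊘-CSG (a * a) ca)))
    where
    a≢0 = CSG.outside-nonzero ca (outside nx)
    x/a²/a⁻¹≡x/a : ∀ x → x * (a * a) ⁻¹ * (a ⁻¹) ⁻¹ ≡ x * a ⁻¹
    x/a²/a⁻¹≡x/a x = begin
      x * (a * a) ⁻¹ * (a ⁻¹) ⁻¹  ≡⟨ cong₂ _*_ (x/a²≡x/a/a x a≢0) (⁻¹-involutive a≢0) ⟩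
      x * a ⁻¹ * a ⁻¹ * a         ≡⟨ solve 3 (λ x i a → x :* i :* i :* a := x :* i :* (i :* a)) refl x (a ⁻¹) a ⟩
      x * a ⁻¹ * (a ⁻¹ * a)       ≡⟨ cong (x * a ⁻¹ *_) (x⁻¹*x≡1 a≢0) ⟩
      x * a ⁻¹ * 1#               ≡⟨ *-identityʳ _ ⟩
      x * a ⁻¹                    ∎

  -- if x f = x then u(x) f = u(x): from P a A b B = A and ab - a ∈ A, divide by a
  u-least : ∀ {x f} → NonNeutral x → NonNeutral f → x ⊡ f ≈ x → uQ F x ⊡ f ≈ uQ F x
  u-least {a , A} {b , B} nx@(ca , _) (cb , _) xf≈x = ≈-intro cP′ (P′⊆A/a , A/a⊆P′)
      (A/a⊆P′ (a * b - a , P⊆A ab-a , (begin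
         1# * b - 1#                ≡⟨ cong (λ o → o * b - o) (sym (⁻¹-inverse a a≢0)) ⟩
         a * a ⁻¹ * b - a * a ⁻¹    ≡⟨ solve 3 (λ a i b → a :* i :* b :- a :* i := (a :* b :- a) :* i) refl a (a ⁻¹) b ⟩
         (a * b - a) * a ⁻¹         ∎)))
    where
    a≢0 = CSG.outside-nonzero ca (outside nx)
    cA/a = ⊘-CSG a ca
    cP′ = P-CSG 1# b cA/a cb
    P≐A = ≈-elim (P-CSG a b ca cb) ca xf≈x
    P⊆A : P a A b B ⊆ A
    P⊆A = proj₁ (proj₁ P≐A)
    A⊆P : A ⊆ P a A b B
    A⊆P = proj₂ (proj₁ P≐A)
    ab-a : P a A b B (a * b - a)
    ab-a = proj₂ P≐A
    P′⊆A/a : P 1# (A ⊘ˢ a) b B ⊆ A ⊘ˢ a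
    P′⊆A/a = P-lub cA/a
      (λ {β} bβ → a * β , P⊆A (aB⊆P ca cb bβ) , (begin
          1# * β           ≡⟨ cong (_* β) (sym (⁻¹-inverse a a≢0)) ⟩
          a * a ⁻¹ * β     ≡⟨ solve 3 (λ a i β → a :* i :* β := a :* β :* i) refl a (a ⁻¹) β ⟩
          a * β * a ⁻¹     ∎))
      (λ { (x , ax , refl) → b * x , P⊆A (bA⊆P ca cb ax) , solve 3 (λ b x i → b :* (x :* i) := b :* x :* i) refl b x (a ⁻¹) })
      (λ { {β = β} (x , ax , refl) bβ → x * β , P⊆A (AB⊆P ca cb ax bβ) , solve 3 (λ x i β → x :* i :* β := x :* β :* i) refl x (a ⁻¹) β })
    A/a⊆P′ : A ⊘ˢ a ⊆ P 1# (A ⊘ˢ a) b B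
    A/a⊆P′ (x , ax , refl) = P-cases (A⊆P ax) λ {β} {α} {α′} {β′} bβ aα aα′ bβ′ x≡ →
      CSG.∈-resp cP′ (P-intro bβ (α , aα , refl) (α′ , aα′ , refl) bβ′) (begin
        1# * β + b * (α * a ⁻¹) + α′ * a ⁻¹ * β′
          ≡⟨ cong (λ o → o * β + b * (α * a ⁻¹) + α′ * a ⁻¹ * β′) (sym (⁻¹-inverse a a≢0)) ⟩
        a * a ⁻¹ * β + b * (α * a ⁻¹) + α′ * a ⁻¹ * β′
          ≡⟨ solve 7 (λ a i β b α α′ β′ → a :* i :* β :+ b :* (α :* i) :+ α′ :* i :* β′ := (a :* β :+ b :* α :+ α′ :* β′) :* i) refl a (a ⁻¹) β b α α′ β′ ⟩
        (a * β + b * α + α′ * β′) * a ⁻¹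
          ≡⟨ cong (_* a ⁻¹) (sym x≡) ⟩
        x * a ⁻¹ ∎)


  comparable-reps : ∀ {a A a′ A′} → NonNeutral (a , A) → NonNeutral (a′ , A′) → (a , A) ≈ (a′ , A′) →
                    (∣ a′ ∣ ≤ ∣ a ∣ + ∣ a ∣) × (∣ a ∣ ≤ ∣ a′ ∣ + ∣ a′ ∣)
  comparable-reps nx@(ca , _) ny@(ca′ , _) x≈y =
    let ((A⊆A′ , _) , a-a′) = ≈-elim ca ca′ x≈y in
    comparable ca (outside nx) a-a′ , comparable ca′ (outside ny) (A⊆A′ (CSG.swap-closed ca a-a′))

  u-cong : ∀ {x y} → NonNeutral x → NonNeutral y → x ≈ y → uQ F x ≈ uQ F y
  u-cong {a , A} {a′ , A′} nx@(ca , _) ny@(ca′ , _) x≈y = ≈-intro (⊘-CSG a ca)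
      ((λ t → ⊘-mono A⊆A′ (⊘-divisor ca a≢0 a′≢0 a′≤2a t)) , (λ t → ⊘-mono A′⊆A (⊘-divisor ca′ a′≢0 a≢0 a≤2a′ t)))
      (1-1∈ (⊘-CSG a ca))
    where
    A⊆A′ = proj₁ (proj₁ (≈-elim ca ca′ x≈y))
    A′⊆A = proj₂ (proj₁ (≈-elim ca ca′ x≈y))
    a≢0 = CSG.outside-nonzero ca (outside nx)
    a′≢0 = CSG.outside-nonzero ca′ (outside ny)
    a′≤2a = proj₁ (comparable-reps nx ny x≈y)
    a≤2a′ = proj₂ (comparable-reps nx ny x≈y)

  -- 1/a - 1/a′ = ((a′ - a)(a / a′)) / a² with ∣ a / a′ ∣ ≤ 2
  d-cong : ∀ {x y} → NonNeutral x → NonNeutral y → x ≈ y → dQ F x ≈ dQ F y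
  d-cong {a , A} {a′ , A′} nx@(ca , _) ny@(ca′ , _) x≈y = ≈-intro (⊘-CSG (a * a) ca)
      ((λ t → ⊘-mono A⊆A′ (⊘-divisor² ca a≢0 a′≢0 a′≤2a t)) , (λ t → ⊘-mono A′⊆A (⊘-divisor² ca′ a′≢0 a≢0 a≤2a′ t)))
      ((a′ - a) * (a * a′ ⁻¹) , doubled-closed ca a′-a (ratio-≤2 a′≢0 a≤2a′) , (begin
        a ⁻¹ - a′ ⁻¹
          ≡⟨ solve 2 (λ i j → i :- j := :1 :* :1 :* i :- :1 :* :1 :* j) refl (a ⁻¹) (a′ ⁻¹) ⟩
        1# * 1# * a ⁻¹ - 1# * 1# * a′ ⁻¹
          ≡⟨ cong₂ (λ o p → o * p * a ⁻¹ - p * p * a′ ⁻¹) (sym (⁻¹-inverse a′ a′≢0)) (sym (⁻¹-inverse a a≢0)) ⟩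
        (a′ * a′ ⁻¹) * (a * a ⁻¹) * a ⁻¹ - (a * a ⁻¹) * (a * a ⁻¹) * a′ ⁻¹
          ≡⟨ solve 4 (λ a a′ i j → a′ :* j :* (a :* i) :* i :- a :* i :* (a :* i) :* j := (a′ :- a) :* (a :* j) :* (i :* i)) refl a a′ (a ⁻¹) (a′ ⁻¹) ⟩
        (a′ - a) * (a * a′ ⁻¹) * (a ⁻¹ * a ⁻¹)
          ≡⟨ cong ((a′ - a) * (a * a′ ⁻¹) *_) (sym (⁻¹-*-homo a≢0 a≢0)) ⟩
        (a′ - a) * (a * a′ ⁻¹) * (a * a) ⁻¹ ∎))
    where
    A⊆A′ = proj₁ (proj₁ (≈-elim ca ca′ x≈y))
    A′⊆A = proj₂ (proj₁ (≈-elim ca ca′ x≈y))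
    a′-a = CSG.swap-closed ca (proj₂ (≈-elim ca ca′ x≈y))
    a≢0 = CSG.outside-nonzero ca (outside nx)
    a′≢0 = CSG.outside-nonzero ca′ (outside ny)
    a′≤2a = proj₁ (comparable-reps nx ny x≈y)
    a≤2a′ = proj₂ (comparable-reps nx ny x≈y)

  u-∗ : ∀ {x y} → NonNeutral x → NonNeutral y → (uQ F (x ⊡ y) ≈ uQ F x) ⊎ (uQ F (x ⊡ y) ≈ uQ F y)
  u-∗ {a , A} {b , B} nx@(ca , _) ny@(cb , _) with u-⊡ ca cb (outside nx) (outside ny)
  ... | inj₁ P/ab≐A/a = inj₁ (≈-intro (⊘-CSG (a * b) (P-CSG a b ca cb)) P/ab≐A/a (1-1∈ (⊘-CSG (a * b) (P-CSG a b ca cb))))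
  ... | inj₂ P/ab≐B/b = inj₂ (≈-intro (⊘-CSG (a * b) (P-CSG a b ca cb)) P/ab≐B/b (1-1∈ (⊘-CSG (a * b) (P-CSG a b ca cb))))

  ·-assembly : IsAssemblyOn _≈_ NonNeutral _⊡_ (uQ F) (dQ F)
  ·-assembly = record
    { isEquivalence = ≈-isEquivalence
    ; nonempty = (1# , zeroCSG) , zeroCSG-isCSG , ∉⇒non-neutral zeroCSG-isCSG (λ 1≡0 → 0≢1 (sym 1≡0))
    ; ∗-closed = ⊡-closed
    ; ∗-cong = λ nx nx′ ny ny′ → ·-cong (proj₁ nx) (proj₁ nx′) (proj₁ ny) (proj₁ ny′)
    ; assoc = λ nx ny nz → ·-assoc (proj₁ nx) (proj₁ ny) (proj₁ nz)
    ; comm = λ nx ny → ·-comm (proj₁ nx) (proj₁ ny)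
    ; e-closed = u-closed
    ; e-cong = u-cong
    ; e-neutral = u-neutral
    ; e-least = u-least
    ; s-closed = d-closed
    ; s-cong = d-cong
    ; s-inverse = d-inverse
    ; e-s = u-d
    ; e-∗ = u-∗
    }

module CosetAssociation {ℓ} (F : OrderedField ℓ) (em : ExcludedMiddle ℓ) where
  open OrderedField F
  open OrderedFieldFacts F
  open ConvexSubgroups F em
  open Cosets F em
  open ProductLaws F em
  open MultiplicativeAssembly F em
  open AdditiveAssembly F em using (+-assembly)

  -- (4): e(u(x)) = e(x) d(x), i.e. A/a = 0 (A/a²) + A/a + A (A/a²)
  e-u : ∀ {x} → InQ F x → ¬ x ≈ eQ F x → eQ F (uQ F x) ≈ eQ F x ⊡ dQ F x
  e-u {a , A} ca a≉0 = ≈-intro (⊘-CSG a ca) (swap (P-over-a² ca a∉A 0[A/a²]⊆A/a))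
      (CSG.0≡-closed (⊘-CSG a ca) (solve 1 (λ i → :0 := :0 :- :0 :* i) refl (a ⁻¹)))
    where
    a∉A = non-neutral⇒∉ ca a≉0
    swap : ∀ {S T} → S ≐ T → T ≐ S
    swap (S⊆T , T⊆S) = T⊆S , S⊆T
    0[A/a²]⊆A/a : ∀ {x} → A x → (A ⊘ˢ a) (0# * (x * (a * a) ⁻¹))
    0[A/a²]⊆A/a _ = CSG.0*-closed (⊘-CSG a ca)

  isAssociation : IsAssociationOn _≈_ (InQ F) _⊞_ _⊡_ (eQ F) (sQ F) (uQ F) (dQ F)
  isAssociation = record
    { +-assembly = +-assembly
    ; ·-closed = ·-closed
    ; ·-cong = ·-cong
    ; ·-assembly = ·-assembly
    ; distrib = distrib
    ; e·-is-e = λ {x} {y} → e·-is-e {x} {y}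
    ; e-· = e-·
    ; e-u = e-u
    ; s-· = s-·
    }

-- For cosets y = b + B and z = c + C, y ≤ z holds exactly
-- when either y ⊆ z up to a shift inside C ("contained": B ⊆ C and
-- b - c ∈ C) or z lies entirely above y ("separated": c - b ≥ 0 and
-- c - b ∉ B).
module CosetOrder {ℓ} (F : OrderedField ℓ) (em : ExcludedMiddle ℓ) where
  open OrderedField F
  open OrderedFieldFacts F
  open ConvexSubgroups F em
  open Cosets F em
  open ProductSets F em

  infix 4 _≼_
  _≼_ : Rep F → Rep F → Set ℓ
  _≼_ = _≤Q_ F

  Contained Separated : Rep F → Rep F → Set ℓ
  Contained (b , B) (c , C) = (B ⊆ C) × C (b - c)
  Separated (b , B) (c , C) = (0# ≤ c - b) × ¬ B (c - b)

  ≼-contained : ∀ {y z} → InQ F z → Contained y z → y ≼ z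
  ≼-contained {b , B} {c , C} cc (B⊆C , b-c) x (β , bβ , refl) =
    b + β , ((b - c) + β , CSG.+-closed cc b-c (B⊆C bβ) , solve 3 (λ b c β → b :+ β := c :+ ((b :- c) :+ β)) refl b c β) , ≤-refl

  -- every b + β is at most c, since ∣ β ∣ ≤ c - b
  ≼-separated : ∀ {y z} → InQ F y → InQ F z → Separated y z → y ≼ z
  ≼-separated {b , B} {c , C} cb cc (0≤c-b , c-b∉B) x (β , bβ , refl) =
    c , (0# , CSG.0∈ cc , sym (+-identityʳ c)) ,
    ≤-resp refl (solve 2 (λ b c → b :+ (c :- b) := c) refl b c)
      (+-monoʳ-≤ b (≤-trans (x≤∣x∣ β) (≤-resp refl (∣x∣≡x 0≤c-b) (CSG.outside-dominates cb c-b∉B bβ))))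

  private
    cancel-shift : ∀ {u s c γ} → u ≡ c + s → u ≤ c + γ → s ≤ γ
    cancel-shift {c = c} refl p = +-cancelˡ-≤ c p

  -- if y ≤ z and c - b ∈ B then B ⊆ C: an element t ∈ B ∖ C would give
  -- c + 2∣ t ∣ ∈ y lying below some c + γ ∈ z, whence 2∣ t ∣ ≤ γ ≤ ∣ t ∣
  ≼-meeting : ∀ {b B c C} → IsCSG B → IsCSG C → (b , B) ≼ (c , C) → B (c - b) → B ⊆ C
  ≼-meeting {b} {B} {c} {C} cb cc y≼z c-b∈B {t} bt with em {C t}
  ... | yes ct = ct
  ... | no t∉C = ⊥-elim (t∉C (CSG.0≡-closed cc (sym (∣x∣≤0⇒x≡0 ∣t∣≤0))))
    where
    s = ∣ t ∣ + ∣ t ∣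
    witness = y≼z (b + ((c - b) + s)) ((c - b) + s , CSG.+-closed cb c-b∈B (CSG.double-closed cb (CSG.∣∣-closed cb bt)) , refl)
    γ = proj₁ (proj₁ (proj₂ witness))
    cγ : C γ
    cγ = proj₁ (proj₂ (proj₁ (proj₂ witness)))
    s≤γ : s ≤ γ
    s≤γ = cancel-shift (solve 3 (λ b c s → b :+ ((c :- b) :+ s) := c :+ s) refl b c s)
                       (≤-resp refl (proj₂ (proj₂ (proj₁ (proj₂ witness)))) (proj₂ (proj₂ witness)))
    ∣t∣≤0 : ∣ t ∣ ≤ 0#
    ∣t∣≤0 = +-cancelˡ-≤ ∣ t ∣ (≤-resp refl (trans (sym (+-identityˡ ∣ t ∣)) (+-comm 0# ∣ t ∣))
              (≤-trans s≤γ (≤-trans (x≤∣x∣ γ) (CSG.outside-dominates cc t∉C cγ))))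

  -- if y ≤ z and c ≤ b then b - c ∈ C: b lies below some c + γ, so 0 ≤ b - c ≤ γ
  ≼-reversed : ∀ {b B c C} → IsCSG B → IsCSG C → (b , B) ≼ (c , C) → c - b ≤ 0# → C (b - c)
  ≼-reversed {b} {B} {c} {C} cb cc y≼z c-b≤0 = CSG.convex cc (CSG.0∈ cc) cγ 0≤b-c b-c≤γ
    where
    witness = y≼z b (0# , CSG.0∈ cb , sym (+-identityʳ b))
    γ = proj₁ (proj₁ (proj₂ witness))
    cγ : C γ
    cγ = proj₁ (proj₂ (proj₁ (proj₂ witness)))
    b-c≤γ : b - c ≤ γ
    b-c≤γ = cancel-shift (solve 2 (λ b c → b := c :+ (b :- c)) refl b c)
                         (≤-resp refl (proj₂ (proj₂ (proj₁ (proj₂ witness)))) (proj₂ (proj₂ witness)))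
    0≤b-c : 0# ≤ b - c
    0≤b-c = ≤-resp refl (solve 2 (λ b c → :- (c :- b) := b :- c) refl b c) (x≤0⇒0≤-x c-b≤0)

  ≼-cases : ∀ {y z} → InQ F y → InQ F z → y ≼ z → Contained y z ⊎ Separated y z
  ≼-cases {b , B} {c , C} cb cc y≼z with em {B (c - b)}
  ... | yes c-b∈B = inj₁ (B⊆C , B⊆C (CSG.swap-closed cb c-b∈B))
    where B⊆C = ≼-meeting cb cc y≼z c-b∈B
  ... | no c-b∉B with total 0# (c - b)
  ...   | inj₁ 0≤c-b = inj₂ (0≤c-b , c-b∉B)
  ...   | inj₂ c-b≤0 with ⊆-total cb cc
  ...     | inj₁ B⊆C = inj₁ (B⊆C , ≼-reversed cb cc y≼z c-b≤0)
  ...     | inj₂ C⊆B = ⊥-elim (c-b∉B (CSG.swap-closed cb (C⊆B (≼-reversed cb cc y≼z c-b≤0))))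

  ≼-reflexive : ∀ {y z} → y ≈ z → y ≼ z
  ≼-reflexive y≈z t t∈y = t , proj₁ (y≈z t) t∈y , ≤-refl

  ≼-trans : ∀ {x y z} → x ≼ y → y ≼ z → x ≼ z
  ≼-trans x≼y y≼z t t∈x =
    let (u , u∈y , t≤u) = x≼y t t∈x ; (v , v∈z , u≤v) = y≼z u u∈y in v , v∈z , ≤-trans t≤u u≤v

  -- two separations, or a separation and a containment, contradict each other
  ≼-antisym : ∀ {y z} → InQ F y → InQ F z → y ≼ z → z ≼ y → y ≈ z
  ≼-antisym {a , A} {b , B} ca cb y≼z z≼y with ≼-cases ca cb y≼z | ≼-cases cb ca z≼y
  ... | inj₁ (A⊆B , a-b) | inj₁ (B⊆A , b-a) = ≈-intro ca (A⊆B , B⊆A) (CSG.swap-closed ca b-a)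
  ... | inj₁ (_ , a-b)   | inj₂ (_ , a-b∉B) = ⊥-elim (a-b∉B a-b)
  ... | inj₂ (_ , b-a∉A) | inj₁ (_ , b-a)   = ⊥-elim (b-a∉A b-a)
  ... | inj₂ (0≤b-a , b-a∉A) | inj₂ (0≤a-b , _) = ⊥-elim (b-a∉A (CSG.0≡-closed ca (sym b-a≡0)))
    where
    b-a≡0 : b - a ≡ 0#
    b-a≡0 = antisym (≤-resp (solve 2 (λ a b → :- (a :- b) := b :- a) refl a b) neg-0# (neg-anti-≤ 0≤a-b)) 0≤b-a

  -- when A ⊆ B, compare the representatives modulo B
  ≼-total-⊆ : ∀ {a A b B} → IsCSG A → IsCSG B → A ⊆ B → ((a , A) ≼ (b , B)) ⊎ ((b , B) ≼ (a , A))
  ≼-total-⊆ {a} {A} {b} {B} ca cb A⊆B with em {B (a - b)} | total 0# (b - a)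
  ... | yes a-b∈B | _ = inj₁ (≼-contained cb (A⊆B , a-b∈B))
  ... | no a-b∉B | inj₁ 0≤b-a = inj₁ (≼-separated ca cb (0≤b-a , λ b-a∈A → a-b∉B (CSG.swap-closed cb (A⊆B b-a∈A))))
  ... | no a-b∉B | inj₂ b-a≤0 =
    inj₂ (≼-separated cb ca (≤-resp refl (solve 2 (λ a b → :- (b :- a) := a :- b) refl a b) (x≤0⇒0≤-x b-a≤0) , a-b∉B))

  ≼-total : ∀ {y z} → InQ F y → InQ F z → (y ≼ z) ⊎ (z ≼ y)
  ≼-total {a , A} {b , B} ca cb with ⊆-total ca cb
  ... | inj₁ A⊆B = ≼-total-⊆ ca cb A⊆B
  ... | inj₂ B⊆A = [ inj₂ , inj₁ ]′ (≼-total-⊆ cb ca B⊆A)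

  -- translate a witness t ≤ u by an element of z
  ≼-+-mono : ∀ {x y z} → x ≼ y → x ⊞ z ≼ y ⊞ z
  ≼-+-mono {a , A} {b , B} {c , C} x≼y t (_ , (α , γ , aα , cγ , refl) , refl) =
    let (u , (β , bβ , u≡) , a+α≤u) = x≼y (a + α) (α , aα , refl) in
    u + (c + γ) ,
    (β + γ , ⊕-intro bβ cγ , trans (cong (_+ (c + γ)) u≡) (solve 4 (λ b β c γ → b :+ β :+ (c :+ γ) := b :+ c :+ (β :+ γ)) refl b β c γ)) ,
    ≤-resp (solve 4 (λ a c α γ → a :+ α :+ (c :+ γ) := a :+ c :+ (α :+ γ)) refl a c α γ) refl (+-mono-≤ (c + γ) a+α≤u)

  -- (2): y + e(x) = e(x) means B ⊆ A and b ∈ A, so y and s(y) are contained in A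
  e-bound : ∀ {x y} → InQ F x → InQ F y → y ⊞ eQ F x ≈ eQ F x → (y ≼ eQ F x) × (sQ F y ≼ eQ F x)
  e-bound {a , A} {b , B} ca cb y+A≈A =
    ≼-contained ca (B⊆A , CSG.∈-resp ca b∈A (sym (b-0≡b b))) ,
    ≼-contained ca (B⊆A , CSG.∈-resp ca (CSG.neg-closed ca b∈A) (sym (b-0≡b (- b))))
    where
    b-0≡b : ∀ b → b - 0# ≡ b
    b-0≡b = solve 1 (λ b → b :- :0 := b) refl
    B⊕A≐A = ≈-elim (⊕-CSG cb ca) ca y+A≈A
    B⊆A : B ⊆ A
    B⊆A bβ = proj₁ (proj₁ B⊕A≐A) (⊕-inl ca bβ)
    b∈A : A b
    b∈A = CSG.∈-resp ca (proj₁ (proj₁ B⊕A≐A) (proj₂ B⊕A≐A)) (solve 1 (λ b → b :+ :0 :- :0 := b) refl b)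

  positive-part : ∀ {a A} → IsCSG A → (0# , A) ≼ (a , A) → ¬ (0# , A) ≈ (a , A) → (0# ≤ a) × ¬ A a
  positive-part {a} ca e≼x e≉x with ≼-cases ca ca e≼x
  ... | inj₁ (_ , 0-a∈A) = ⊥-elim (e≉x (≈-intro ca ≐-refl 0-a∈A))
  ... | inj₂ (0≤a-0 , a-0∉A) = ≤-resp refl (a-0≡a a) 0≤a-0 , λ a∈A → a-0∉A (CSG.∈-resp ca a∈A (sym (a-0≡a a)))
    where
    a-0≡a : ∀ a → a - 0# ≡ a
    a-0≡a = solve 1 (λ a → a :- :0 := a) refl

  private
    -x≤a⇒0≤a+x : ∀ {a x} → - x ≤ a → 0# ≤ a + x
    -x≤a⇒0≤a+x {a} {x} p = ≤-resp (solve 1 (λ x → :- x :+ x := :0) refl x) refl (+-mono-≤ x p)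

  dominant : ∀ {a A α} → IsCSG A → 0# ≤ a → ¬ A a → A α → (0# ≤ a + α) × (a ≤ (a + α) + (a + α))
  dominant {a} {A} {α} ca 0≤a a∉A aα =
      -x≤a⇒0≤a+x (bound aα)
    , ≤-resp (+-identityˡ a) (solve 2 (λ a α → a :+ (α :+ α) :+ a := (a :+ α) :+ (a :+ α)) refl a α)
        (+-mono-≤ a (-x≤a⇒0≤a+x (bound (CSG.double-closed ca aα))))
    where
    bound : ∀ {t} → A t → - t ≤ a
    bound {t} at = ≤-trans (-x≤∣x∣ t) (≤-resp refl (∣x∣≡x 0≤a) (CSG.outside-dominates ca a∉A at))

  -- the key estimate for (3): aβ + α′β′ ≤ d(a + α) when 0 ≤ a ∉ A and 0 ≤ d ∉ B;
  -- with s = ∣ β ∣ + ∣ β′ ∣ we have 2s ∈ B, so aβ + α′β′ ≤ a s ≤ 2s (a + α) ≤ d (a + α)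
  product-estimate : ∀ {a A d B α α′ β β′} → IsCSG A → IsCSG B → 0# ≤ a → ¬ A a → 0# ≤ d → ¬ B d →
                     A α → A α′ → B β → B β′ → a * β + α′ * β′ ≤ d * (a + α)
  product-estimate {a} {A} {d} {B} {α} {α′} {β} {β′} ca cb 0≤a a∉A 0≤d d∉B aα aα′ bβ bβ′ =
    ≤-trans (+-mono₂-≤ aβ≤ α′β′≤) (≤-trans (≤-reflexive (sym as≡sa)) (≤-trans (*-monoˡ-≤ 0≤s a≤2[a+α])
      (≤-trans (≤-reflexive s2≡2s) (*-monoʳ-≤ 0≤a+α 2s≤d))))
    where
    s = ∣ β ∣ + ∣ β′ ∣
    0≤s : 0# ≤ s
    0≤s = ≤-resp (+-identityˡ 0#) refl (+-mono₂-≤ (0≤∣x∣ β) (0≤∣x∣ β′))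
    2s≤d : s + s ≤ d
    2s≤d = ≤-resp (∣x∣≡x (0≤x+x 0≤s)) (∣x∣≡x 0≤d)
             (CSG.outside-dominates cb d∉B (CSG.double-closed cb (CSG.+-closed cb (CSG.∣∣-closed cb bβ) (CSG.∣∣-closed cb bβ′))))
    0≤a+α = proj₁ (dominant ca 0≤a a∉A aα)
    a≤2[a+α] = proj₂ (dominant ca 0≤a a∉A aα)
    aβ≤ : a * β ≤ a * ∣ β ∣
    aβ≤ = *-monoˡ-≤ 0≤a (x≤∣x∣ β)
    α′β′≤ : α′ * β′ ≤ a * ∣ β′ ∣
    α′β′≤ = ≤-trans (x≤∣x∣ (α′ * β′)) (≤-resp (sym (∣x*y∣≡∣x∣*∣y∣ α′ β′)) refl
              (*-monoʳ-≤ (0≤∣x∣ β′) (≤-resp refl (∣x∣≡x 0≤a) (CSG.outside-dominates ca a∉A aα′))))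
    as≡sa : s * a ≡ a * ∣ β ∣ + a * ∣ β′ ∣
    as≡sa = solve 3 (λ a u v → (u :+ v) :* a := a :* u :+ a :* v) refl a (∣ β ∣) (∣ β′ ∣)
    s2≡2s : s * ((a + α) + (a + α)) ≡ (s + s) * (a + α)
    s2≡2s = solve 3 (λ s a α → s :* ((a :+ α) :+ (a :+ α)) := (s :+ s) :* (a :+ α)) refl s a α

  -- (3) when y, z are separated: ab + (aβ + bα + α′β′) lies below ac + cα
  ·-mono-separated : ∀ {a A b B c C} → IsCSG A → IsCSG B → IsCSG C → 0# ≤ a → ¬ A a →
                     Separated (b , B) (c , C) → (a , A) ⊡ (b , B) ≼ (a , A) ⊡ (c , C)
  ·-mono-separated {a} {A} {b} {B} {c} {C} ca cb cc 0≤a a∉A (0≤c-b , c-b∉B) _ (p , pp , refl) =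
    P-cases pp λ {β} {α} {α′} {β′} bβ aα aα′ bβ′ p≡ →
      a * c + c * α , (c * α , bA⊆P ca cc aα , refl) ,
      ≤-resp (trans (solve 7 (λ a b α β α′ β′ p → a :* b :+ b :* α :+ (a :* β :+ α′ :* β′) := a :* b :+ (a :* β :+ b :* α :+ α′ :* β′)) refl a b α β α′ β′ p)
                    (cong (a * b +_) (sym p≡)))
             (solve 4 (λ a b c α → a :* b :+ b :* α :+ (c :- b) :* (a :+ α) := a :* c :+ c :* α) refl a b c α)
        (+-monoʳ-≤ (a * b + b * α) (product-estimate ca cb 0≤a a∉A 0≤c-b c-b∉B aα aα′ bβ bβ′))

  ·-mono : ∀ {x y z} → InQ F x → InQ F y → InQ F z → ((eQ F x ≼ x) × ¬ eQ F x ≈ x) × (y ≼ z) → x ⊡ y ≼ x ⊡ z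
  ·-mono {a , A} {b , B} {c , C} ca cb cc ((e≼x , e≉x) , y≼z) with positive-part ca e≼x e≉x | ≼-cases cb cc y≼z
  ... | 0≤a , a∉A | inj₂ separated = ·-mono-separated ca cb cc 0≤a a∉A separated
  ... | _ | inj₁ (B⊆C , b-c) = ≼-contained cP (P-mono ca cc (λ α → α) B⊆C a-a∈A b-c , ab-ac∈P)
    where
    cP = P-CSG a c ca cc
    a-a∈A : A (a - a)
    a-a∈A = CSG.0≡-closed ca (solve 1 (λ a → :0 := a :- a) refl a)
    ab-ac∈P : P a A c C (a * b - a * c)
    ab-ac∈P = CSG.∈-resp cP (aB⊆P ca cc b-c) (solve 3 (λ a b c → a :* (b :- c) := a :* b :- a :* c) refl a b c)

  nonnegative-part : ∀ {b B} → IsCSG B → (0# , B) ≼ (b , B) → B b ⊎ (0# ≤ b)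
  nonnegative-part {b} cb e≼y with ≼-cases cb cb e≼y
  ... | inj₁ (_ , 0-b∈B) = inj₁ (CSG.∈-resp cb (CSG.swap-closed cb 0-b∈B) (solve 1 (λ b → b :- :0 := b) refl b))
  ... | inj₂ (0≤b-0 , _) = inj₂ (≤-resp refl (solve 1 (λ b → b :- :0 := b) refl b) 0≤b-0)

  c-dominates : ∀ {b B c} → IsCSG B → B b ⊎ (0# ≤ b) → 0# ≤ c - b → ¬ B (c - b) →
                (∣ b ∣ ≤ ∣ c ∣) × (∀ {β} → B β → ∣ β ∣ ≤ ∣ c ∣)
  c-dominates {b} {B} {c} cb (inj₁ b∈B) _ c-b∉B = outside-dominates b∈B , outside-dominates
    where
    c∉B : ¬ B c
    c∉B c∈B = c-b∉B (CSG.sub-closed cb c∈B b∈B)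
    outside-dominates : ∀ {β} → B β → ∣ β ∣ ≤ ∣ c ∣
    outside-dominates = CSG.outside-dominates cb c∉B
  c-dominates {b} {B} {c} cb (inj₂ 0≤b) 0≤c-b c-b∉B =
      ≤-resp (sym (∣x∣≡x 0≤b)) (sym ∣c∣≡c) b≤c
    , λ bβ → ≤-trans (≤-resp refl (∣x∣≡x 0≤c-b) (CSG.outside-dominates cb c-b∉B bβ)) (≤-resp refl (sym ∣c∣≡c) c-b≤c)
    where
    c≡b+[c-b] : b + (c - b) ≡ c
    c≡b+[c-b] = solve 2 (λ b c → b :+ (c :- b) := c) refl b c
    b≤c : b ≤ c
    b≤c = ≤-resp (+-identityʳ b) c≡b+[c-b] (+-monoʳ-≤ b 0≤c-b)
    c-b≤c : c - b ≤ c
    c-b≤c = ≤-resp (+-identityˡ (c - b)) c≡b+[c-b] (+-mono-≤ (c - b) 0≤b)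
    ∣c∣≡c : ∣ c ∣ ≡ c
    ∣c∣≡c = ∣x∣≡x (≤-trans 0≤b b≤c)

  -- (4): e(y) ≤ y ≤ z implies e(x)y ≤ e(x)z, since 0·B + bA + AB ⊆ 0·C + cA + AC
  e·-mono : ∀ {x y z} → InQ F x → InQ F y → InQ F z → (eQ F y ≼ y) × (y ≼ z) → eQ F x ⊡ y ≼ eQ F x ⊡ z
  e·-mono {a , A} {b , B} {c , C} ca cb cc (e≼y , y≼z) =
    ≼-contained cP (P⊆ (≼-cases cb cc y≼z) , CSG.0≡-closed cP (solve 2 (λ b c → :0 := :0 :* b :- :0 :* c) refl b c))
    where
    cP = P-CSG 0# c ca cc
    -- everything below ∣ c α ∣ lies in cA ⊆ P 0 A c C
    below-cα : ∀ {u α} → A α → ∣ u ∣ ≤ ∣ c ∣ → ∣ u * α ∣ ≤ ∣ c * α ∣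
    below-cα {u} {α} _ p = ≤-resp (sym (∣x*y∣≡∣x∣*∣y∣ u α)) (sym (∣x*y∣≡∣x∣*∣y∣ c α)) (*-monoʳ-≤ (0≤∣x∣ α) p)
    P⊆ : Contained (b , B) (c , C) ⊎ Separated (b , B) (c , C) → P 0# A b B ⊆ P 0# A c C
    P⊆ (inj₁ (B⊆C , b-c)) = P-mono ca cc (λ α → α) B⊆C (CSG.0≡-closed ca (solve 0 (:0 := :0 :- :0) refl)) b-c
    P⊆ (inj₂ (0≤c-b , c-b∉B)) = P-lub cP (λ _ → CSG.0*-closed cP)
      (λ {α} aα → CSG.∣∣-down cP (bA⊆P ca cc aα) (below-cα aα (proj₁ dom)))
      (λ {α} {β} aα bβ → CSG.∣∣-down cP (bA⊆P ca cc aα)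
        (≤-resp (cong ∣_∣ (*-comm β α)) refl (below-cα aα (proj₂ dom bβ))))
      where dom = c-dominates cb (nonnegative-part cb e≼y) 0≤c-b c-b∉B

  isOrderedAssociation : IsOrderedAssociationOn _≈_ (InQ F) _⊞_ _⊡_ (eQ F) (sQ F) (uQ F) (dQ F) _≼_
  isOrderedAssociation = record
    { isAssociation = CosetAssociation.isAssociation F em
    ; ≤-reflexive = λ _ _ → ≼-reflexive
    ; ≤-trans = λ _ _ _ → ≼-trans
    ; ≤-antisym = ≼-antisym
    ; ≤-total = ≼-total
    ; +-mono = λ _ _ _ → ≼-+-mono
    ; e-bound = λ {x} {y} → e-bound {x} {y}
    ; ·-mono = λ {x} {y} {z} → ·-mono {x} {y} {z}
    ; e·-mono = λ {x} {y} {z} → e·-mono {x} {y} {z}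
    }

-- Theorem 4.8.  The construction works in every ordered field; being
-- non-archimedean only ensures that Q has convex subgroups besides 0 and F.
theorem4p8 : ∀ {ℓ} (F : OrderedField ℓ) → ExcludedMiddle ℓ → NonArchimedean F →
    IsOrderedAssociationOn (_≈Q_ F) (InQ F) (_+Q_ F) (_·Q_ F) (eQ F) (sQ F) (uQ F) (dQ F) (_≤Q_ F)
theorem4p8 F em _ = CosetOrder.isOrderedAssociation F em
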